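{- Let $\lambda=(\lambda_1,\dots,\lambda_\ell)$ be a partition of $n$. The map $R\mapsto\operatorname{perm}_{\mathrm{SRT}}(R)$ is an injection from the set of special rim hook tableaux of shape $\lambda$ into $S_\ell$, and $\operatorname{sgn}(R)=\operatorname{sgn}(\operatorname{perm}_{\mathrm{SRT}}(R))$ for every such $R$.
   Context: For a partition $\lambda=(\lambda_1\ge\dots\ge\lambda_\ell>0)$, its Ferrers diagram is the set of cells $(i,j)$, $1\le i\le\ell$, $1\le j\le\lambda_i$ (row $i$ from the top). A rim hook is a connected skew diagram (difference of two Ferrers diagrams of partitions) containing no $2\times2$ square. A special rim hook tableau (SRT) of shape $\lambda$ is a partition of the diagram of $\lambda$ into rim hooks each containing a cell of the first column. The initial cell of a rim hook is its northeastern-most cell; the terminal cell is its southwestern-most cell. The $d$-th diagonal is $\mathcal L_d=\{(d+k,1+k):k\in\mathbb Z\}$; each diagonal contains at most one initial cell of an SRT. $\operatorname{perm}_{\mathrm{SRT}}(R)=\sigma$ is defined for $i\in[\ell]$ by: if $\mathcal L_{i-\lambda_i+1}$ contains no initial cell, $\sigma_i=i-\lambda_i$; otherwise $\sigma_i$ is the row of the terminal cell of the rim hook whose initial cell lies in $\mathcal L_{i-\lambda_i+1}$ (this is a permutation of $[\ell]$). The sign of $R$ is $\operatorname{sgn}(R)=(-1)^k$, where $k$ is the total number of rows crossed by the rim hooks, i.e. the sum over all rim hooks of (number of rows the hook occupies $-1$). -}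

module Defs where

open import Data.Nat using (ℕ; zero; suc; _≤_; _<_; _<ᵇ_)
open import Data.Integer as ℤ using (ℤ; +_; -_; _-_)
open import Data.Nat.ListAction using (sum)
open import Data.List using (List; []; _∷_; length; filter; map; lookup; allFin; cartesianProduct; foldr)
open import Data.List.Relation.Unary.All using (All)
open import Data.List.Membership.Propositional using (_∈_)
open import Data.Fin using (Fin; toℕ)
open import Data.Fin.Properties using (_<?_)
open import Data.Product using (Σ; Σ-syntax; _×_; _,_; proj₁; proj₂)
open import Data.Sum using (_⊎_)
open import Data.Bool using (Bool; true; false; _∧_)
open import Relation.Nullary using (¬_; does)
open import Relation.Binary.PropositionalEquality using (_≡_)
open import Data.Fin.Permutation using (Permutation′; _⟨$⟩ʳ_)

-- Cells are pairs (row , column), 1-based; rows counted from the top.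
Cell : Set
Cell = ℕ × ℕ

-- 1-based parts of a partition given as a list; part μ 0 = 0 and part μ i = 0 for i > length μ.
part : List ℕ → ℕ → ℕ
part μ zero = zero
part [] (suc i) = zero
part (x ∷ μ) (suc zero) = x
part (x ∷ μ) (suc (suc i)) = part μ (suc i)

IsPartition : List ℕ → Set
IsPartition μ = All (λ x → 1 ≤ x) μ × (∀ i → part μ (suc (suc i)) ≤ part μ (suc i))

IsPartitionOf : ℕ → List ℕ → Set
IsPartitionOf n μ = IsPartition μ × sum μ ≡ n

InDiagram : List ℕ → Cell → Set
InDiagram μ (i , j) = 1 ≤ i × i ≤ length μ × 1 ≤ j × j ≤ part μ i

IsSkew : List Cell → Set
IsSkew H = Σ[ μ ∈ List ℕ ] Σ[ ν ∈ List ℕ ] IsPartition μ × IsPartition ν ×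
  (∀ c → (c ∈ H → InDiagram μ c × ¬ InDiagram ν c) × (InDiagram μ c × ¬ InDiagram ν c → c ∈ H))

Adj : Cell → Cell → Set
Adj (i , j) (i' , j') = (i ≡ i' × (suc j ≡ j' ⊎ j ≡ suc j')) ⊎ (j ≡ j' × (suc i ≡ i' ⊎ i ≡ suc i'))

data Reach (H : List Cell) (c : Cell) : Cell → Set where
  here : c ∈ H → Reach H c c
  step : ∀ {d e} → Reach H c d → Adj d e → e ∈ H → Reach H c e

Connected : List Cell → Set
Connected H = ∀ c d → c ∈ H → d ∈ H → Reach H c d

No2x2 : List Cell → Set
No2x2 H = ∀ i j → ¬ ((i , j) ∈ H × (suc i , j) ∈ H × (i , suc j) ∈ H × (suc i , suc j) ∈ H)

IsRimHook : List Cell → Set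
IsRimHook H = IsSkew H × Connected H × No2x2 H

IsSRT : List ℕ → List (List Cell) → Set
IsSRT μ R =
  All IsRimHook R ×
  All (λ H → Σ[ i ∈ ℕ ] (i , 1) ∈ H) R ×
  All (λ H → ∀ c → c ∈ H → InDiagram μ c) R ×
  (∀ c → InDiagram μ c → Σ[ k ∈ Fin (length R) ] c ∈ lookup R k) ×
  (∀ c (k k' : Fin (length R)) → c ∈ lookup R k → c ∈ lookup R k' → k ≡ k')

-- Two SRTs are equal iff they consist of the same rim hooks (as sets of cells).
SameHooks : List Cell → List Cell → Set
SameHooks H H' = ∀ c → (c ∈ H → c ∈ H') × (c ∈ H' → c ∈ H)

SameSRT : List (List Cell) → List (List Cell) → Set
SameSRT R R' = (∀ H → H ∈ R → Σ[ H' ∈ List Cell ] H' ∈ R' × SameHooks H H')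
             × (∀ H' → H' ∈ R' → Σ[ H ∈ List Cell ] H ∈ R × SameHooks H H')

IsInitial : List Cell → Cell → Set
IsInitial H (i , j) = (i , j) ∈ H × (∀ i' j' → (i' , j') ∈ H → i ≤ i' × j' ≤ j)

IsTerminal : List Cell → Cell → Set
IsTerminal H (i , j) = (i , j) ∈ H × (∀ i' j' → (i' , j') ∈ H → i' ≤ i × j ≤ j')

OnDiag : ℤ → Cell → Set
OnDiag d (i , j) = Σ[ k ∈ ℤ ] (+ i ≡ d ℤ.+ k) × (+ j ≡ + 1 ℤ.+ k)

-- σ = perm_SRT(R), as a relation: σ is a function on [ℓ] (encoded as Fin ℓ, row
-- r = toℕ i + 1) satisfying the defining clauses.
PermSRT : (μ : List ℕ) → List (List Cell) → (Fin (length μ) → Fin (length μ)) → Set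
PermSRT μ R σ = ∀ (i : Fin (length μ)) →
  let r = suc (toℕ i)
      d = (+ r - + part μ r) ℤ.+ + 1
      s = + suc (toℕ (σ i))
  in (¬ (Σ[ H ∈ List Cell ] Σ[ c ∈ Cell ] H ∈ R × IsInitial H c × OnDiag d c) → s ≡ + r - + part μ r)
   × (∀ H c t → H ∈ R → IsInitial H c → OnDiag d c → IsTerminal H t → s ≡ + proj₁ t)

sgnOf : ℕ → ℤ
sgnOf zero = + 1
sgnOf (suc k) = - sgnOf k

anyRow : ℕ → List Cell → Bool
anyRow i [] = false
anyRow i ((i' , _) ∷ H) = does (i Data.Nat.≟ i') Data.Bool.∨ anyRow i H

maxRow : List Cell → ℕ
maxRow = foldr (λ c m → proj₁ c Data.Nat.⊔ m) 0

rowsOccupied : List Cell → ℕ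
rowsOccupied H = length (filter (λ i → anyRow i H Data.Bool.≟ true) (Data.List.upTo (suc (maxRow H))))

sgnSRT : List (List Cell) → ℤ
sgnSRT R = sgnOf (sum (map (λ H → rowsOccupied H Data.Nat.∸ 1) R))

inversions : ∀ {ℓ} → (Fin ℓ → Fin ℓ) → ℕ
inversions {ℓ} σ = length (filter (λ p → (proj₁ p <? proj₂ p) Relation.Nullary.×-dec (σ (proj₂ p) <? σ (proj₁ p)))
                                  (cartesianProduct (allFin ℓ) (allFin ℓ)))

sgnPerm : ∀ {ℓ} → Permutation′ ℓ → ℤ
sgnPerm π = sgnOf (inversions (π ⟨$⟩ʳ_))

-- Induction on the number of hooks, over shapes with a fixed number L of possibly empty rows.
-- Let ℓ be the last nonempty row and H the hook through (ℓ , 1). Every other hook reaches the first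
-- column, so H has no cell weakly north-west of a cell of another hook; hence H is the whole outer
-- rim of rows a, …, ℓ. Removing it moves rows a + 1, …, ℓ up by one and shortens them by one, which
-- keeps their diagonals, while the diagonal of row a carries the initial cell of H, whose terminal
-- row is ℓ. So perm_SRT(R) is perm_SRT(R ∖ H) composed with the cycle sending a to ℓ and each of
-- a + 1, …, ℓ one row up. That cycle has ℓ - a inversions and H crosses ℓ - a rows, which gives the
-- sign; and σ determines a as the row it sends to ℓ, hence H, which gives injectivity.

module Submission where

open import Defs
open import Data.Bool as Bool using (Bool; true; false; _∧_; _∨_)
open import Data.Bool.Properties using (∧-zeroʳ)
open import Data.Nat as ℕ using (ℕ; zero; suc; pred; _+_; _*_; _∸_; _⊔_; _≤_; _<_; _≤?_; _<?_; _≟_; z≤n; s≤s; s≤s⁻¹)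
open import Data.Nat.Properties
import Data.Nat.ListAction as List
open import Algebra.Properties.CommutativeSemigroup +-commutativeSemigroup using (x∙yz≈y∙xz)
open import Algebra.Properties.Semiring.Sum +-*-semiring using (sum; sum-cong-≗; ∑-distrib-+; sum-permute; *-distribˡ-sum; *-distribʳ-sum)
open import Data.Integer as ℤ using (ℤ; +_; -_; _-_)
open import Data.Integer.Properties using (pos-+; +-injective)
open import Data.Integer.Tactic.RingSolver using (solve-∀)
open import Data.Fin as Fin using (Fin; toℕ; fromℕ<)
import Data.Fin.Properties as Finₚ
open import Data.Fin.Permutation as Perm using (Permutation′; permutation; _⟨$⟩ʳ_; _∘ₚ_)
open import Data.List using (List; []; _∷_; _++_; length; lookup; removeAt; map; filter; tabulate; applyUpTo; upTo; cartesianProduct)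
open import Data.List.Properties using (length-++; filter-++; map-tabulate; length-removeAt′)
open import Data.List.Extrema ≤-totalOrder using (argmin; argmin-all; f[argmin]≤f[xs])
open import Data.List.Membership.Propositional using (_∈_; _∉_)
open import Data.List.Membership.Propositional.Properties using (∈-lookup)
open import Data.List.Relation.Unary.All as All using (All)
open import Data.List.Relation.Unary.Any using (here; there; index)
open import Data.List.Relation.Unary.Any.Properties using (lookup-index)
open import Data.Product as Product using (Σ-syntax; ∃-syntax; _×_; _,_; proj₁; proj₂)
open import Data.Sum using (_⊎_; inj₁; inj₂; [_,_]′)
open import Data.Empty using (⊥; ⊥-elim)
open import Function using (id; _∘_; _⇔_; mk⇔; Injective; Injection)
open import Function.Properties.Inverse using (↔⇒↣)
open import Relation.Binary.PropositionalEquality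
open import Relation.Binary.Definitions using (tri<; tri≈; tri>)
open import Relation.Nullary using (Dec; yes; no; does; ¬_; contradiction; _×-dec_)
open import Relation.Nullary.Decidable using (dec-true; dec-false; does-⇔; toSum)
open import Relation.Unary using (Pred; Decidable)

rotate : ℕ → ℕ → ℕ → ℕ
rotate A E x with <-cmp x A
... | tri< _ _ _ = x
... | tri≈ _ _ _ = E
... | tri> _ _ _ with x ≤? E
...   | yes _ = pred x
...   | no _ = x

unrotate : ℕ → ℕ → ℕ → ℕ
unrotate A E y with <-cmp y E
... | tri≈ _ _ _ = A
... | tri> _ _ _ = y
... | tri< _ _ _ with y <? A
...   | yes _ = y
...   | no _ = suc y

module _ {A E : ℕ} where

  rotate-below : ∀ {x} → x < A → rotate A E x ≡ x
  rotate-below {x} x<A with <-cmp x A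
  ... | tri< _ _ _ = refl
  ... | tri≈ x≮A _ _ = contradiction x<A x≮A
  ... | tri> x≮A _ _ = contradiction x<A x≮A

  rotate-start : rotate A E A ≡ E
  rotate-start with <-cmp A A
  ... | tri< _ A≢A _ = contradiction refl A≢A
  ... | tri≈ _ _ _ = refl
  ... | tri> _ A≢A _ = contradiction refl A≢A

  rotate-inside : ∀ {y} → A ≤ y → y < E → rotate A E (suc y) ≡ y
  rotate-inside {y} A≤y y<E with <-cmp (suc y) A
  ... | tri< _ _ A≮y+1 = contradiction (s≤s A≤y) A≮y+1
  ... | tri≈ _ _ A≮y+1 = contradiction (s≤s A≤y) A≮y+1
  ... | tri> _ _ _ with suc y ≤? E
  ...   | yes _ = refl
  ...   | no y+1≰E = contradiction y<E y+1≰E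

  rotate-above : ∀ {x} → A ≤ E → E < x → rotate A E x ≡ x
  rotate-above {x} A≤E E<x with <-cmp x A
  ... | tri< x<A _ _ = contradiction (<-trans x<A (≤-<-trans A≤E E<x)) (<-irrefl refl)
  ... | tri≈ _ x≡A _ = contradiction (subst (_< x) (sym x≡A) (≤-<-trans A≤E E<x)) (<-irrefl refl)
  ... | tri> _ _ _ with x ≤? E
  ...   | yes x≤E = contradiction x≤E (<⇒≱ E<x)
  ...   | no _ = refl

  unrotate-below : ∀ {y} → A ≤ E → y < A → unrotate A E y ≡ y
  unrotate-below {y} A≤E y<A with <-cmp y E
  ... | tri< _ _ _ with y <? A
  ...   | yes _ = refl
  ...   | no y≮A = contradiction y<A y≮A
  unrotate-below A≤E y<A | tri≈ y≮E _ _ = contradiction (<-≤-trans y<A A≤E) y≮E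
  unrotate-below A≤E y<A | tri> y≮E _ _ = contradiction (<-≤-trans y<A A≤E) y≮E

  unrotate-inside : ∀ {y} → A ≤ y → y < E → unrotate A E y ≡ suc y
  unrotate-inside {y} A≤y y<E with <-cmp y E
  ... | tri≈ y≮E _ _ = contradiction y<E y≮E
  ... | tri> y≮E _ _ = contradiction y<E y≮E
  ... | tri< _ _ _ with y <? A
  ...   | yes y<A = contradiction A≤y (<⇒≱ y<A)
  ...   | no _ = refl

  unrotate-end : unrotate A E E ≡ A
  unrotate-end with <-cmp E E
  ... | tri< _ E≢E _ = contradiction refl E≢E
  ... | tri≈ _ _ _ = refl
  ... | tri> _ E≢E _ = contradiction refl E≢E

  unrotate-above : ∀ {y} → E < y → unrotate A E y ≡ y
  unrotate-above {y} E<y with <-cmp y E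
  ... | tri< _ _ E≮y = contradiction E<y E≮y
  ... | tri≈ _ _ E≮y = contradiction E<y E≮y
  ... | tri> _ _ _ = refl

  data Region : ℕ → Set where
    below  : ∀ {x} → x < A → Region x
    start  : Region A
    inside : ∀ {y} → A ≤ y → y < E → Region (suc y)
    above  : ∀ {x} → E < x → Region x

  region : ∀ x → Region x
  region x with <-cmp x A
  ... | tri< x<A _ _ = below x<A
  ... | tri≈ _ refl _ = start
  region (suc y) | tri> _ _ A<y+1 with suc y ≤? E
  ...   | yes y<E = inside (≤-pred A<y+1) y<E
  ...   | no y+1≰E = above (≰⇒> y+1≰E)

  module _ (A≤E : A ≤ E) where

    unrotate-rotate : ∀ x → unrotate A E (rotate A E x) ≡ x
    unrotate-rotate x with region x
    ... | below x<A = trans (cong (unrotate A E) (rotate-below x<A)) (unrotate-below A≤E x<A)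
    ... | start = trans (cong (unrotate A E) rotate-start) unrotate-end
    ... | inside A≤y y<E = trans (cong (unrotate A E) (rotate-inside A≤y y<E)) (unrotate-inside A≤y y<E)
    ... | above E<x = trans (cong (unrotate A E) (rotate-above A≤E E<x)) (unrotate-above E<x)

    rotate-unrotate : ∀ y → rotate A E (unrotate A E y) ≡ y
    rotate-unrotate y with <-cmp y E
    ... | tri≈ _ y≡E _ = trans rotate-start (sym y≡E)
    ... | tri> _ _ E<y = rotate-above A≤E E<y
    ... | tri< y<E _ _ with y <? A
    ...   | yes y<A = rotate-below y<A
    ...   | no y≮A = rotate-inside (≮⇒≥ y≮A) y<E

    rotate-< : ∀ {L x} → E < L → x < L → rotate A E x < L
    rotate-< {x = x} E<L x<L with <-cmp x A
    ... | tri< _ _ _ = x<L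
    ... | tri≈ _ _ _ = E<L
    ... | tri> _ _ _ with x ≤? E
    ...   | yes _ = ≤-<-trans pred[n]≤n x<L
    ...   | no _ = x<L

    unrotate-< : ∀ {L y} → E < L → y < L → unrotate A E y < L
    unrotate-< {y = y} E<L y<L with <-cmp y E
    ... | tri≈ _ _ _ = ≤-<-trans A≤E E<L
    ... | tri> _ _ _ = y<L
    ... | tri< y<E _ _ with y <? A
    ...   | yes _ = y<L
    ...   | no _ = <-≤-trans (s≤s y<E) E<L

    rotate-mono-< : ∀ {x y} → x < y → ¬ (x ≡ A × A < y × y ≤ E) → rotate A E x < rotate A E y
    rotate-mono-< {x} {y} x<y ¬rev with region x | region y
    ... | below x<A | below y<A rewrite rotate-below x<A | rotate-below y<A = x<y
    ... | below x<A | start rewrite rotate-below x<A | rotate-start = <-≤-trans x<A A≤E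
    ... | below x<A | inside A≤y y<E rewrite rotate-below x<A | rotate-inside A≤y y<E = <-≤-trans x<A A≤y
    ... | below x<A | above E<y rewrite rotate-below x<A | rotate-above A≤E E<y = x<y
    ... | start | below y<A = contradiction y<A (<-asym x<y)
    ... | start | start = contradiction x<y (<-irrefl refl)
    ... | start | inside A≤y y<E = contradiction (refl , s≤s A≤y , y<E) ¬rev
    ... | start | above E<y rewrite rotate-start | rotate-above A≤E E<y = E<y
    ... | inside A≤x _ | below y<A = contradiction (<-trans x<y y<A) (≤⇒≯ (m≤n⇒m≤1+n A≤x))
    ... | inside A≤x _ | start = contradiction x<y (≤⇒≯ (m≤n⇒m≤1+n A≤x))
    ... | inside A≤x x<E | inside A≤y y<E rewrite rotate-inside A≤x x<E | rotate-inside A≤y y<E = ≤-pred x<y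
    ... | inside A≤x x<E | above E<y rewrite rotate-inside A≤x x<E | rotate-above A≤E E<y = <-trans x<E E<y
    ... | above E<x | below y<A = contradiction (<-trans (<-trans E<x x<y) y<A) (≤⇒≯ A≤E)
    ... | above E<x | start = contradiction (<-trans E<x x<y) (≤⇒≯ A≤E)
    ... | above E<x | inside _ y<E = contradiction (<-trans E<x x<y) (≤⇒≯ y<E)
    ... | above E<x | above E<y rewrite rotate-above A≤E E<x | rotate-above A≤E E<y = x<y

    rotate-inside′ : ∀ {x} → A < x → x ≤ E → A ≤ rotate A E x × rotate A E x < E
    rotate-inside′ {suc y} A<x x≤E rewrite rotate-inside {y} (≤-pred A<x) x≤E = ≤-pred A<x , x≤E

    rotate-cancel-< : ∀ {x y} → rotate A E x < rotate A E y → ¬ (y ≡ A × A < x × x ≤ E) → x < y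
    rotate-cancel-< {x} {y} rx<ry ¬rev with <-cmp x y
    ... | tri< x<y _ _ = x<y
    ... | tri≈ _ refl _ = contradiction rx<ry (<-irrefl refl)
    ... | tri> _ _ y<x = contradiction rx<ry (<-asym (rotate-mono-< y<x ¬rev))

module Rotation {L A E : ℕ} (A≤E : A ≤ E) (E<L : E < L) where

  rotateF : Fin L → Fin L
  rotateF i = fromℕ< (rotate-< A≤E E<L (Finₚ.toℕ<n i))

  unrotateF : Fin L → Fin L
  unrotateF i = fromℕ< (unrotate-< A≤E E<L (Finₚ.toℕ<n i))

  toℕ-rotateF : ∀ i → toℕ (rotateF i) ≡ rotate A E (toℕ i)
  toℕ-rotateF i = Finₚ.toℕ-fromℕ< _

  toℕ-unrotateF : ∀ i → toℕ (unrotateF i) ≡ unrotate A E (toℕ i)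
  toℕ-unrotateF i = Finₚ.toℕ-fromℕ< _

  rotateF-unrotateF : ∀ i → rotateF (unrotateF i) ≡ i
  rotateF-unrotateF i = Finₚ.toℕ-injective (begin
    toℕ (rotateF (unrotateF i))    ≡⟨ toℕ-rotateF (unrotateF i) ⟩
    rotate A E (toℕ (unrotateF i)) ≡⟨ cong (rotate A E) (toℕ-unrotateF i) ⟩
    rotate A E (unrotate A E (toℕ i)) ≡⟨ rotate-unrotate A≤E (toℕ i) ⟩
    toℕ i ∎)
    where open ≡-Reasoning

  unrotateF-rotateF : ∀ i → unrotateF (rotateF i) ≡ i
  unrotateF-rotateF i = Finₚ.toℕ-injective (begin
    toℕ (unrotateF (rotateF i))    ≡⟨ toℕ-unrotateF (rotateF i) ⟩
    unrotate A E (toℕ (rotateF i)) ≡⟨ cong (unrotate A E) (toℕ-rotateF i) ⟩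
    unrotate A E (rotate A E (toℕ i)) ≡⟨ unrotate-rotate A≤E (toℕ i) ⟩
    toℕ i ∎)
    where open ≡-Reasoning

  rotation : Permutation′ L
  rotation = permutation rotateF unrotateF rotateF-unrotateF unrotateF-rotateF

  rotateF-start : ∀ {i} → toℕ i ≡ A → toℕ (rotateF i) ≡ E
  rotateF-start {i} i≡A = trans (toℕ-rotateF i) (trans (cong (rotate A E) i≡A) (rotate-start {A}))

  rotateF-inside : ∀ {i} → A < toℕ i → toℕ i ≤ E → A ≤ toℕ (rotateF i) × toℕ (rotateF i) < E
  rotateF-inside {i} A<i i≤E rewrite toℕ-rotateF i = rotate-inside′ A≤E A<i i≤E

  unrotateF-injective : ∀ {x y} → unrotateF x ≡ unrotateF y → x ≡ y
  unrotateF-injective {x} {y} eq = trans (sym (rotateF-unrotateF x)) (trans (cong rotateF eq) (rotateF-unrotateF y))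

indicator : Bool → ℕ
indicator true = 1
indicator false = 0

module _ {a p} {X : Set a} {P : Pred X p} (P? : Decidable P) where

  length-filter-∷ : ∀ x xs → length (filter P? (x ∷ xs)) ≡ indicator (does (P? x)) + length (filter P? xs)
  length-filter-∷ x xs with does (P? x)
  ... | true = refl
  ... | false = refl

  length-filter-++ : ∀ xs ys → length (filter P? (xs ++ ys)) ≡ length (filter P? xs) + length (filter P? ys)
  length-filter-++ xs ys = trans (cong length (filter-++ P? xs ys)) (length-++ (filter P? xs))

  length-filter-tabulate : ∀ {n} (g : Fin n → X) → length (filter P? (tabulate g)) ≡ sum (indicator ∘ does ∘ P? ∘ g)
  length-filter-tabulate {zero} g = refl
  length-filter-tabulate {suc n} g =
    trans (length-filter-∷ (g Fin.zero) _) (cong (_+_ (indicator (does (P? (g Fin.zero))))) (length-filter-tabulate (g ∘ Fin.suc)))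

  length-filter-applyUpTo : ∀ n (g : ℕ → X) → length (filter P? (applyUpTo g n)) ≡ sum {n} (indicator ∘ does ∘ P? ∘ g ∘ toℕ)
  length-filter-applyUpTo zero g = refl
  length-filter-applyUpTo (suc n) g =
    trans (length-filter-∷ (g 0) _) (cong (_+_ (indicator (does (P? (g 0))))) (length-filter-applyUpTo n (g ∘ suc)))

length-filter-cartesianProduct : ∀ {a b p} {X : Set a} {Y : Set b} {P : Pred (X × Y) p} (P? : Decidable P)
  {m n} (f : Fin m → X) (g : Fin n → Y) →
  length (filter P? (cartesianProduct (tabulate f) (tabulate g))) ≡ sum {m} (λ i → sum {n} (λ j → indicator (does (P? (f i , g j)))))
length-filter-cartesianProduct P? {zero} f g = refl
length-filter-cartesianProduct P? {suc m} {n} f g = begin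
  length (filter P? (map (f Fin.zero ,_) (tabulate g) ++ cartesianProduct (tabulate (f ∘ Fin.suc)) (tabulate g)))
    ≡⟨ length-filter-++ P? (map (f Fin.zero ,_) (tabulate g)) _ ⟩
  length (filter P? (map (f Fin.zero ,_) (tabulate g))) + length (filter P? (cartesianProduct (tabulate (f ∘ Fin.suc)) (tabulate g)))
    ≡⟨ cong₂ _+_ (trans (cong (length ∘ filter P?) (map-tabulate g (f Fin.zero ,_))) (length-filter-tabulate P? ((f Fin.zero ,_) ∘ g)))
                 (length-filter-cartesianProduct P? (f ∘ Fin.suc) g) ⟩
  sum {n} (λ j → indicator (does (P? (f Fin.zero , g j)))) + sum {m} (λ i → sum {n} (λ j → indicator (does (P? (f (Fin.suc i) , g j))))) ∎
  where open ≡-Reasoning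

sum-zero : ∀ {n} (g : Fin n → ℕ) → (∀ i → g i ≡ 0) → sum g ≡ 0
sum-zero {zero} g g≗0 = refl
sum-zero {suc n} g g≗0 = cong₂ _+_ (g≗0 Fin.zero) (sum-zero (g ∘ Fin.suc) (g≗0 ∘ Fin.suc))

count-≤ : ∀ {n} E → E < n → sum {n} (λ i → indicator (does (toℕ i ≤? E))) ≡ suc E
count-≤ {suc n} zero _ = cong suc (sum-zero {n} _ (λ _ → refl))
count-≤ {suc n} (suc E) (s≤s E<n) =
  cong suc (trans (sum-cong-≗ {n} (λ i → cong indicator (does-⇔ (mk⇔ s≤s⁻¹ s≤s) (suc (toℕ i) ≤? suc E) (toℕ i ≤? E))))
                  (count-≤ E E<n))

count-interval : ∀ {n} A E → E < n → sum {n} (λ i → indicator (does (A <? toℕ i) ∧ does (toℕ i ≤? E))) ≡ E ∸ A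
count-interval {suc n} zero zero _ = sum-zero {n} _ (λ _ → refl)
count-interval {suc n} zero (suc E) (s≤s E<n) =
  trans (sum-cong-≗ {n} (λ i → cong indicator (does-⇔ (mk⇔ s≤s⁻¹ s≤s) (suc (toℕ i) ≤? suc E) (toℕ i ≤? E))))
        (count-≤ E E<n)
count-interval {suc n} (suc A) zero _ = sum-zero {n} _ (λ i → cong indicator (∧-zeroʳ _))
count-interval {suc n} (suc A) (suc E) (s≤s E<n) =
  trans (sum-cong-≗ {n} (λ i → cong₂ (λ b c → indicator (b ∧ c))
                                      (does-⇔ (mk⇔ s≤s⁻¹ s≤s) (suc (suc A) ≤? suc (toℕ i)) (suc A ≤? toℕ i))
                                      (does-⇔ (mk⇔ s≤s⁻¹ s≤s) (suc (toℕ i) ≤? suc E) (toℕ i ≤? E))))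
        (count-interval A E E<n)

count-point : ∀ {n} A → A < n → sum {n} (λ i → indicator (does (toℕ i ≟ A))) ≡ 1
count-point {suc n} zero _ = cong suc (sum-zero {n} _ (λ _ → refl))
count-point {suc n} (suc A) (s≤s A<n) =
  trans (sum-cong-≗ {n} (λ i → cong indicator (does-⇔ (mk⇔ suc-injective (cong suc)) (suc (toℕ i) ≟ suc A) (toℕ i ≟ A))))
        (count-point A A<n)

isInversion : ∀ {L} → (Fin L → Fin L) → Fin L → Fin L → ℕ
isInversion σ p q = indicator (does (p Finₚ.<? q) ∧ does (σ q Finₚ.<? σ p))

inversions-as-sum : ∀ {L} (σ : Fin L → Fin L) → inversions σ ≡ sum (λ p → sum (λ q → isInversion σ p q))
inversions-as-sum {L} σ = length-filter-cartesianProduct (λ (p , q) → (p Finₚ.<? q) ×-dec (σ q Finₚ.<? σ p)) {L} {L} (λ i → i) (λ i → i)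

inversions-cong : ∀ {L} {σ τ : Fin L → Fin L} → (∀ i → σ i ≡ τ i) → inversions σ ≡ inversions τ
inversions-cong {σ = σ} {τ} σ≗τ = begin
  inversions σ                                ≡⟨ inversions-as-sum σ ⟩
  sum (λ p → sum (λ q → isInversion σ p q))
    ≡⟨ sum-cong-≗ (λ p → sum-cong-≗ (λ q → cong₂ (λ u v → indicator (does (p Finₚ.<? q) ∧ does (u Finₚ.<? v))) (σ≗τ q) (σ≗τ p))) ⟩
  sum (λ p → sum (λ q → isInversion τ p q))   ≡⟨ inversions-as-sum τ ⟨
  inversions τ ∎
  where open ≡-Reasoning

inversions-id : ∀ {L} → inversions {L} (λ i → i) ≡ 0
inversions-id {L} = trans (inversions-as-sum {L} (λ i → i)) (sum-zero {L} _ (λ p → sum-zero {L} _ (λ q → no-inversion p q)))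
  where
  no-inversion : ∀ p q → isInversion (λ i → i) p q ≡ 0
  no-inversion p q = by-cases (p Finₚ.<? q) (q Finₚ.<? p)
    where
    by-cases : (p<?q : Dec (p Fin.< q)) (q<?p : Dec (q Fin.< p)) → indicator (does p<?q ∧ does q<?p) ≡ 0
    by-cases (yes p<q) (yes q<p) = contradiction q<p (<⇒≯ p<q)
    by-cases (yes _) (no _) = refl
    by-cases (no _) _ = refl

sgnOf-+ : ∀ k {m m′} → sgnOf m ≡ sgnOf m′ → sgnOf (k + m) ≡ sgnOf (k + m′)
sgnOf-+ zero eq = eq
sgnOf-+ (suc k) eq = cong -_ (sgnOf-+ k eq)

module _ {L A E : ℕ} (A≤E : A ≤ E) (E<L : E < L) where
  open Rotation A≤E E<L

  atA : Fin L → ℕ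
  atA p = indicator (does (toℕ p ≟ A))

  inInterval : Fin L → ℕ
  inInterval q = indicator (does (A <? toℕ q) ∧ does (toℕ q ≤? E))

  reversedPair : Fin L → Fin L → ℕ
  reversedPair p q = atA p * inInterval q

  sum-reversedPair : sum (λ p → sum (λ q → reversedPair p q)) ≡ E ∸ A
  sum-reversedPair = begin
    sum (λ p → sum (λ q → atA p * inInterval q)) ≡⟨ sum-cong-≗ (λ p → sym (*-distribˡ-sum (atA p) inInterval)) ⟩
    sum (λ p → atA p * sum inInterval)           ≡⟨ sym (*-distribʳ-sum (sum inInterval) atA) ⟩
    sum atA * sum inInterval                     ≡⟨ cong₂ _*_ (count-point A (≤-<-trans A≤E E<L)) (count-interval A E E<L) ⟩
    1 * (E ∸ A)                                  ≡⟨ *-identityˡ (E ∸ A) ⟩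
    E ∸ A ∎
    where open ≡-Reasoning

  module _ (τ : Fin L → Fin L) (τ-max : ∀ p q → A ≤ toℕ p → toℕ p < E → toℕ q ≡ E → τ p Fin.< τ q) where

    isInversion-∘-rotateF : ∀ p q → isInversion (τ ∘ rotateF) p q ≡ isInversion τ (rotateF p) (rotateF q) + reversedPair p q
    isInversion-∘-rotateF p q with (toℕ p ≟ A) ×-dec ((A <? toℕ q) ×-dec (toℕ q ≤? E))
    ... | yes (p≡A , A<q , q≤E) with rotateF-inside A<q q≤E
    ...   | A≤rq , rq<E
      rewrite dec-true (p Finₚ.<? q) (subst (_< toℕ q) (sym p≡A) A<q)
            | dec-true (τ (rotateF q) Finₚ.<? τ (rotateF p)) (τ-max _ _ A≤rq rq<E (rotateF-start p≡A))
            | dec-false (rotateF p Finₚ.<? rotateF q) (<⇒≯ (subst (_ <_) (sym (rotateF-start p≡A)) rq<E))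
            | dec-true (toℕ p ≟ A) p≡A | dec-true (A <? toℕ q) A<q | dec-true (toℕ q ≤? E) q≤E
      = refl
    isInversion-∘-rotateF p q | no ¬rev with (toℕ q ≟ A) ×-dec ((A <? toℕ p) ×-dec (toℕ p ≤? E))
    ... | yes (q≡A , A<p , p≤E)
      rewrite dec-false (p Finₚ.<? q) (<⇒≯ (subst (_< toℕ p) (sym q≡A) A<p))
            | dec-true (rotateF p Finₚ.<? rotateF q) (subst (_ <_) (sym (rotateF-start q≡A)) (proj₂ (rotateF-inside A<p p≤E)))
            | dec-false (τ (rotateF q) Finₚ.<? τ (rotateF p)) (<⇒≯ (τ-max _ _ (proj₁ (rotateF-inside A<p p≤E)) (proj₂ (rotateF-inside A<p p≤E)) (rotateF-start q≡A)))
            | dec-false (toℕ p ≟ A) (>⇒≢ A<p)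
      = refl
    ... | no ¬rev′ =
      trans (cong (λ b → indicator (b ∧ does (τ (rotateF q) Finₚ.<? τ (rotateF p)))) same-order)
            (sym (trans (cong (_+_ (isInversion τ (rotateF p) (rotateF q))) no-correction) (+-identityʳ _)))
      where
      same-order : does (p Finₚ.<? q) ≡ does (rotateF p Finₚ.<? rotateF q)
      same-order = does-⇔ (mk⇔ (λ p<q → subst₂ _<_ (sym (toℕ-rotateF p)) (sym (toℕ-rotateF q)) (rotate-mono-< A≤E p<q ¬rev))
                               (λ rp<rq → rotate-cancel-< A≤E (subst₂ _<_ (toℕ-rotateF p) (toℕ-rotateF q) rp<rq) ¬rev′))
                          (p Finₚ.<? q) (rotateF p Finₚ.<? rotateF q)
      no-correction : reversedPair p q ≡ 0
      no-correction with toℕ p ≟ A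
      ... | no p≢A = cong (λ b → indicator b * inInterval q) (dec-false (toℕ p ≟ A) p≢A)
      ... | yes p≡A =
        trans (cong (λ b → atA p * indicator b) (dec-false ((A <? toℕ q) ×-dec (toℕ q ≤? E)) (λ q-inside → ¬rev (p≡A , q-inside))))
              (*-zeroʳ (atA p))

    inversions-∘-rotateF : inversions (τ ∘ rotateF) ≡ inversions τ + (E ∸ A)
    inversions-∘-rotateF = begin
      inversions (τ ∘ rotateF)
        ≡⟨ inversions-as-sum (τ ∘ rotateF) ⟩
      sum (λ p → sum (λ q → isInversion (τ ∘ rotateF) p q))
        ≡⟨ sum-cong-≗ (λ p → trans (sum-cong-≗ (isInversion-∘-rotateF p)) (∑-distrib-+ _ (reversedPair p))) ⟩
      sum (λ p → sum (λ q → isInversion τ (rotateF p) (rotateF q)) + sum (λ q → reversedPair p q))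
        ≡⟨ ∑-distrib-+ (λ p → sum (λ q → isInversion τ (rotateF p) (rotateF q))) (λ p → sum (reversedPair p)) ⟩
      sum (λ p → sum (λ q → isInversion τ (rotateF p) (rotateF q))) + sum (λ p → sum (λ q → reversedPair p q))
        ≡⟨ cong₂ _+_ unpermute sum-reversedPair ⟩
      inversions τ + (E ∸ A) ∎
      where
      open ≡-Reasoning
      unpermute : sum (λ p → sum (λ q → isInversion τ (rotateF p) (rotateF q))) ≡ inversions τ
      unpermute = begin
        sum (λ p → sum (λ q → isInversion τ (rotateF p) (rotateF q))) ≡⟨ sum-cong-≗ (λ p → sym (sum-permute (isInversion τ (rotateF p)) rotation)) ⟩
        sum (λ p → sum (λ q → isInversion τ (rotateF p) q))           ≡⟨ sym (sum-permute (λ p → sum (isInversion τ p)) rotation) ⟩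
        sum (λ p → sum (λ q → isInversion τ p q))                     ≡⟨ sym (inversions-as-sum τ) ⟩
        inversions τ ∎

module _ {a} {A : Set a} where

  skipIndex : (xs : List A) (k : Fin (length xs)) → Fin (length (removeAt xs k)) → Fin (length xs)
  skipIndex (x ∷ xs) Fin.zero j = Fin.suc j
  skipIndex (x ∷ y ∷ xs) (Fin.suc k) Fin.zero = Fin.zero
  skipIndex (x ∷ y ∷ xs) (Fin.suc k) (Fin.suc j) = Fin.suc (skipIndex (y ∷ xs) k j)

  lookup-removeAt : (xs : List A) (k : Fin (length xs)) (j : Fin (length (removeAt xs k))) →
                    lookup (removeAt xs k) j ≡ lookup xs (skipIndex xs k j)
  lookup-removeAt (x ∷ xs) Fin.zero j = refl
  lookup-removeAt (x ∷ y ∷ xs) (Fin.suc k) Fin.zero = refl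
  lookup-removeAt (x ∷ y ∷ xs) (Fin.suc k) (Fin.suc j) = lookup-removeAt (y ∷ xs) k j

  skipIndex-≢ : (xs : List A) (k : Fin (length xs)) (j : Fin (length (removeAt xs k))) → skipIndex xs k j ≢ k
  skipIndex-≢ (x ∷ xs) Fin.zero j ()
  skipIndex-≢ (x ∷ y ∷ xs) (Fin.suc k) Fin.zero ()
  skipIndex-≢ (x ∷ y ∷ xs) (Fin.suc k) (Fin.suc j) eq = skipIndex-≢ (y ∷ xs) k j (Finₚ.suc-injective eq)

  skipIndex-injective : (xs : List A) (k : Fin (length xs)) {j j′ : Fin (length (removeAt xs k))} →
                        skipIndex xs k j ≡ skipIndex xs k j′ → j ≡ j′
  skipIndex-injective (x ∷ xs) Fin.zero eq = Finₚ.suc-injective eq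
  skipIndex-injective (x ∷ y ∷ xs) (Fin.suc k) {Fin.zero} {Fin.zero} eq = refl
  skipIndex-injective (x ∷ y ∷ xs) (Fin.suc k) {Fin.suc j} {Fin.suc j′} eq =
    cong Fin.suc (skipIndex-injective (y ∷ xs) k (Finₚ.suc-injective eq))

  skipIndex-surjective : (xs : List A) (k k′ : Fin (length xs)) → k′ ≢ k → ∃[ j ] skipIndex xs k j ≡ k′
  skipIndex-surjective (x ∷ xs) Fin.zero Fin.zero k′≢k = contradiction refl k′≢k
  skipIndex-surjective (x ∷ xs) Fin.zero (Fin.suc k′) _ = k′ , refl
  skipIndex-surjective (x ∷ y ∷ xs) (Fin.suc k) Fin.zero _ = Fin.zero , refl
  skipIndex-surjective (x ∷ y ∷ xs) (Fin.suc k) (Fin.suc k′) k′≢k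
    with j , eq ← skipIndex-surjective (y ∷ xs) k k′ (k′≢k ∘ cong Fin.suc) = Fin.suc j , cong Fin.suc eq

  ∈-removeAt⁻ : ∀ {x} (xs : List A) (k : Fin (length xs)) → x ∈ removeAt xs k → x ∈ xs
  ∈-removeAt⁻ xs k x∈ = subst (_∈ xs) (trans (sym (lookup-removeAt xs k (index x∈))) (sym (lookup-index x∈))) (∈-lookup _)

  ∈-removeAt-split : ∀ {x} (xs : List A) (k : Fin (length xs)) → x ∈ xs → x ≡ lookup xs k ⊎ x ∈ removeAt xs k
  ∈-removeAt-split xs k x∈ with index x∈ Fin.≟ k
  ... | yes refl = inj₁ (lookup-index x∈)
  ... | no i≢k with j , eq ← skipIndex-surjective xs k (index x∈) i≢k =
    inj₂ (subst (_∈ removeAt xs k) (trans (lookup-removeAt xs k j) (trans (cong (lookup xs) eq) (sym (lookup-index x∈)))) (∈-lookup j))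

  sum-map-removeAt : ∀ (g : A → ℕ) (xs : List A) k → List.sum (map g xs) ≡ g (lookup xs k) + List.sum (map g (removeAt xs k))
  sum-map-removeAt g (x ∷ xs) Fin.zero = refl
  sum-map-removeAt g (x ∷ xs) (Fin.suc k) =
    trans (cong (_+_ (g x)) (sum-map-removeAt g xs k)) (x∙yz≈y∙xz (g x) (g (lookup xs k)) _)

SameSRT-removeAt : ∀ {R R₂ : List (List Cell)} k k₂ → SameHooks (lookup R k) (lookup R₂ k₂) →
                   SameSRT (removeAt R k) (removeAt R₂ k₂) → SameSRT R R₂
SameSRT-removeAt {R} {R₂} k k₂ same-at (same⇒ , same⇐) = forward , backward
  where
  forward : ∀ G → G ∈ R → Σ[ G₂ ∈ List Cell ] G₂ ∈ R₂ × SameHooks G G₂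
  forward G G∈R with ∈-removeAt-split R k G∈R
  ... | inj₁ refl = lookup R₂ k₂ , ∈-lookup k₂ , same-at
  ... | inj₂ G∈R′ with G₂ , G₂∈R₂′ , same ← same⇒ G G∈R′ = G₂ , ∈-removeAt⁻ R₂ k₂ G₂∈R₂′ , same
  backward : ∀ G₂ → G₂ ∈ R₂ → Σ[ G ∈ List Cell ] G ∈ R × SameHooks G G₂
  backward G₂ G₂∈R₂ with ∈-removeAt-split R₂ k₂ G₂∈R₂
  ... | inj₁ refl = lookup R k , ∈-lookup k , same-at
  ... | inj₂ G₂∈R₂′ with G , G∈R′ , same ← same⇐ G₂ G₂∈R₂′ = G , ∈-removeAt⁻ R k G∈R′ , same

maxRow-upper : ∀ {H : List Cell} {c} → c ∈ H → proj₁ c ≤ maxRow H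
maxRow-upper {x ∷ H} (here refl) = m≤m⊔n (proj₁ x) (maxRow H)
maxRow-upper {x ∷ H} (there c∈H) = ≤-trans (maxRow-upper c∈H) (m≤n⊔m (proj₁ x) (maxRow H))

maxRow-least : ∀ (H : List Cell) {n} → (∀ {c} → c ∈ H → proj₁ c ≤ n) → maxRow H ≤ n
maxRow-least [] _ = z≤n
maxRow-least (x ∷ H) bound = ⊔-lub (bound (here refl)) (maxRow-least H (bound ∘ there))

anyRow-sound : ∀ i (H : List Cell) → anyRow i H ≡ true → ∃[ j ] (i , j) ∈ H
anyRow-sound i ((i′ , j′) ∷ H) = by-cases (i ≟ i′)
  where
  by-cases : (i≟i′ : Dec (i ≡ i′)) → does i≟i′ ∨ anyRow i H ≡ true → ∃[ j ] (i , j) ∈ (i′ , j′) ∷ H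
  by-cases (yes refl) _ = j′ , here refl
  by-cases (no _) found = Product.map₂ there (anyRow-sound i H found)

anyRow-complete : ∀ {i j} (H : List Cell) → (i , j) ∈ H → anyRow i H ≡ true
anyRow-complete {i} {j} ((i′ , j′) ∷ H) = by-cases (i ≟ i′)
  where
  by-cases : (i≟i′ : Dec (i ≡ i′)) → (i , j) ∈ (i′ , j′) ∷ H → does i≟i′ ∨ anyRow i H ≡ true
  by-cases (yes _) _ = refl
  by-cases (no i≢i′) (here refl) = contradiction refl i≢i′
  by-cases (no _) (there ij∈H) = anyRow-complete H ij∈H

InShape : ℕ → (ℕ → ℕ) → Cell → Set
InShape L f (i , j) = 1 ≤ i × i ≤ L × 1 ≤ j × j ≤ f i

-- Rows may be empty, so that removing a hook keeps the number L of rows, the size of the permutations, fixed.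
record Shape (L : ℕ) (f : ℕ → ℕ) : Set where
  field
    step-antitone : ∀ i → f (suc (suc i)) ≤ f (suc i)
    vanishes : ∀ {i} → L < i → f i ≡ 0

module _ {f : ℕ → ℕ} (step-antitone : ∀ i → f (suc (suc i)) ≤ f (suc i)) where

  antitone : ∀ {i i′} → 1 ≤ i → i ≤ i′ → f i′ ≤ f i
  antitone {suc i} _ i≤i′ with k , refl ← m≤n⇒∃[o]m+o≡n i≤i′ = go k
    where
    go : ∀ k → f (suc i + k) ≤ f (suc i)
    go zero = ≤-reflexive (cong f (+-identityʳ (suc i)))
    go (suc k) = ≤-trans (≤-trans (≤-reflexive (cong f (+-suc (suc i) k))) (step-antitone (i + k))) (go k)

record IsTableau (L : ℕ) (f : ℕ → ℕ) (R : List (List Cell)) : Set where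
  field
    rimHooks : All IsRimHook R
    meetFirstColumn : All (λ H → Σ[ i ∈ ℕ ] (i , 1) ∈ H) R
    inShape : All (λ H → ∀ c → c ∈ H → InShape L f c) R
    covers : ∀ c → InShape L f c → Σ[ k ∈ Fin (length R) ] c ∈ lookup R k
    disjoint : ∀ c (k k′ : Fin (length R)) → c ∈ lookup R k → c ∈ lookup R k′ → k ≡ k′

IsConvex : List Cell → Set
IsConvex H = ∀ {i j i′ j′ i″ j″} → (i , j) ∈ H → (i″ , j″) ∈ H →
             i ≤ i′ → i′ ≤ i″ → j ≤ j′ → j′ ≤ j″ → (i′ , j′) ∈ H

diagram-down-closed : ∀ {μ} → IsPartition μ → ∀ {i j i′ j′} → InDiagram μ (i , j) →
                      1 ≤ i′ → i′ ≤ i → 1 ≤ j′ → j′ ≤ j → InDiagram μ (i′ , j′)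
diagram-down-closed (_ , μ-antitone) (_ , i≤ℓ , _ , j≤μᵢ) 1≤i′ i′≤i 1≤j′ j′≤j =
  1≤i′ , ≤-trans i′≤i i≤ℓ , 1≤j′ , ≤-trans j′≤j (≤-trans j≤μᵢ (antitone μ-antitone 1≤i′ i′≤i))

skew⇒convex : ∀ {H} → IsSkew H → IsConvex H
skew⇒convex (μ , ν , μ-partition , ν-partition , H≡μ∖ν) {i} {j} {i′} {j′} {i″} {j″}
            ij∈H i″j″∈H i≤i′ i′≤i″ j≤j′ j′≤j″ =
  proj₂ (H≡μ∖ν (i′ , j′)) (i′j′∈μ , i′j′∉ν)
  where
  ij∈μ∖ν = proj₁ (H≡μ∖ν (i , j)) ij∈H
  1≤i = proj₁ (proj₁ ij∈μ∖ν)
  1≤j = proj₁ (proj₂ (proj₂ (proj₁ ij∈μ∖ν)))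
  i′j′∈μ = diagram-down-closed μ-partition (proj₁ (proj₁ (H≡μ∖ν (i″ , j″)) i″j″∈H))
                               (≤-trans 1≤i i≤i′) i′≤i″ (≤-trans 1≤j j≤j′) j′≤j″
  i′j′∉ν = λ i′j′∈ν → proj₂ ij∈μ∖ν (diagram-down-closed ν-partition i′j′∈ν 1≤i i≤i′ 1≤j j≤j′)

reach-end : ∀ {H c d} → Reach H c d → d ∈ H
reach-end (here d∈H) = d∈H
reach-end (step _ _ d∈H) = d∈H

reach-crosses-column : ∀ {H c d} → Reach H c d → ∀ k → proj₂ c ≤ k → k < proj₂ d →
                       ∃[ t ] (t , k) ∈ H × (t , suc k) ∈ H
reach-crosses-column (here _) k c≤k k<c = contradiction (≤-<-trans c≤k k<c) (<-irrefl refl)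
reach-crosses-column {d = (i′ , j′)} (step {d = (i , j)} path adj e∈H) k c≤k k<j′ with j ≤? k
... | no j≰k = reach-crosses-column path k c≤k (≰⇒> j≰k)
... | yes j≤k with adj
...   | inj₁ (refl , inj₁ refl) rewrite ≤-antisym j≤k (≤-pred k<j′) = i , reach-end path , e∈H
...   | inj₁ (refl , inj₂ refl) = contradiction (<-trans k<j′ (n<1+n j′)) (≤⇒≯ j≤k)
...   | inj₂ (refl , _) = contradiction k<j′ (≤⇒≯ j≤k)

reach-crosses-row : ∀ {H c d} → Reach H c d → ∀ k → proj₁ c ≤ k → k < proj₁ d →
                    ∃[ t ] (k , t) ∈ H × (suc k , t) ∈ H
reach-crosses-row (here _) k c≤k k<c = contradiction (≤-<-trans c≤k k<c) (<-irrefl refl)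
reach-crosses-row {d = (i′ , j′)} (step {d = (i , j)} path adj e∈H) k c≤k k<i′ with i ≤? k
... | no i≰k = reach-crosses-row path k c≤k (≰⇒> i≰k)
... | yes i≤k with adj
...   | inj₂ (refl , inj₁ refl) rewrite ≤-antisym i≤k (≤-pred k<i′) = j , reach-end path , e∈H
...   | inj₂ (refl , inj₂ refl) = contradiction (<-trans k<i′ (n<1+n i′)) (≤⇒≯ i≤k)
...   | inj₁ (refl , _) = contradiction k<i′ (≤⇒≯ i≤k)

module _ {H G : List Cell} (H-convex : IsConvex H) (G-convex : IsConvex G)
         (H-connected : Connected H) (G-connected : Connected G)
         (disjoint : ∀ {c} → c ∈ H → c ∈ G → ⊥)
         {ℓ g : ℕ} (ℓ1∈H : (ℓ , 1) ∈ H) (g1∈G : (g , 1) ∈ G)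
         (G-rows : ∀ {r d} → (r , d) ∈ G → r ≤ ℓ)
         (H-columns : ∀ {s c} → (s , c) ∈ H → 1 ≤ c) where

  private
    NoSameColumn : ℕ → Set
    NoSameColumn c = ∀ {s r} → s ≤ r → (s , c) ∈ H → (r , c) ∈ G → ⊥

    -- H and G both cross from column c + 1 to column c + 2; compare the rows where they do.
    no-same-column-step : ∀ c → NoSameColumn (suc c) → NoSameColumn (suc (suc c))
    no-same-column-step c ih {s} {r} s≤r sc∈H rc∈G
      with reach-crosses-column (H-connected _ _ ℓ1∈H sc∈H) (suc c) (s≤s z≤n) ≤-refl
    ... | t , tc∈H , tc′∈H with r ≤? t
    ...   | yes r≤t = disjoint (H-convex sc∈H tc′∈H s≤r r≤t ≤-refl ≤-refl) rc∈G
    ...   | no r≰t with reach-crosses-column (G-connected _ _ g1∈G rc∈G) (suc c) (s≤s z≤n) ≤-refl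
    ...     | u , uc∈G , uc′∈G with t ≤? u
    ...       | yes t≤u = ih t≤u tc∈H uc∈G
    ...       | no t≰u = disjoint tc′∈H (G-convex uc′∈G rc∈G (<⇒≤ (≰⇒> t≰u)) (<⇒≤ (≰⇒> r≰t)) ≤-refl ≤-refl)

    no-same-column : ∀ c → NoSameColumn c
    no-same-column zero _ s0∈H _ = contradiction (H-columns s0∈H) λ ()
    no-same-column (suc zero) s≤r s1∈H r1∈G = disjoint (H-convex s1∈H ℓ1∈H s≤r (G-rows r1∈G) ≤-refl ≤-refl) r1∈G
    no-same-column (suc (suc c)) = no-same-column-step c (no-same-column (suc c))

  no-southeast : ∀ {s c r d} → (s , c) ∈ H → (r , d) ∈ G → s ≤ r → c ≤ d → ⊥
  no-southeast {s} {c} {r} {d} sc∈H rd∈G s≤r c≤d with c <? d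
  ... | no c≮d = no-same-column c s≤r sc∈H (subst (λ z → (r , z) ∈ G) (sym (≤-antisym c≤d (≮⇒≥ c≮d))) rd∈G)
  ... | yes c<d with reach-crosses-column (G-connected _ _ g1∈G rd∈G) c (H-columns sc∈H) c<d
  ...   | u , uc∈G , _ with s ≤? u
  ...     | yes s≤u = no-same-column c s≤u sc∈H uc∈G
  ...     | no s≰u = disjoint sc∈H (G-convex uc∈G rd∈G (<⇒≤ (≰⇒> s≰u)) s≤r ≤-refl c≤d)

cellDiagonal : Cell → ℤ
cellDiagonal (i , j) = (+ i - + j) ℤ.+ + 1

rowDiagonal : (ℕ → ℕ) → ℕ → ℤ
rowDiagonal f r = cellDiagonal (r , f r)

onDiag-cellDiagonal : ∀ i j → OnDiag (cellDiagonal (i , j)) (i , j)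
onDiag-cellDiagonal i j = + j - + 1 , identity₁ (+ i) (+ j) , identity₂ (+ j)
  where
  identity₁ : ∀ I J → I ≡ ((I - J) ℤ.+ + 1) ℤ.+ (J - + 1)
  identity₁ = solve-∀
  identity₂ : ∀ J → J ≡ + 1 ℤ.+ (J - + 1)
  identity₂ = solve-∀

onDiag⇒cellDiagonal : ∀ {d i j} → OnDiag d (i , j) → d ≡ cellDiagonal (i , j)
onDiag⇒cellDiagonal {d} (k , i≡d+k , j≡1+k) =
  trans (identity d k) (cong₂ (λ I J → (I - J) ℤ.+ + 1) (sym i≡d+k) (sym j≡1+k))
  where
  identity : ∀ D K → D ≡ ((D ℤ.+ K) - (+ 1 ℤ.+ K)) ℤ.+ + 1
  identity = solve-∀

cellDiagonal-≡⇒ : ∀ {i j i′ j′} → cellDiagonal (i , j) ≡ cellDiagonal (i′ , j′) → i + j′ ≡ i′ + j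
cellDiagonal-≡⇒ {i} {j} {i′} {j′} eq = +-injective (begin
  + (i + j′)                                          ≡⟨ pos-+ i j′ ⟩
  + i ℤ.+ + j′                                        ≡⟨ identity (+ i) (+ j) (+ j′) ⟩
  (cellDiagonal (i , j) ℤ.+ (+ j ℤ.+ + j′)) - + 1     ≡⟨ cong (λ D → (D ℤ.+ (+ j ℤ.+ + j′)) - + 1) eq ⟩
  (cellDiagonal (i′ , j′) ℤ.+ (+ j ℤ.+ + j′)) - + 1   ≡⟨ identity′ (+ i′) (+ j) (+ j′) ⟩
  + i′ ℤ.+ + j                                        ≡⟨ pos-+ i′ j ⟨
  + (i′ + j) ∎)
  where
  open ≡-Reasoning
  identity : ∀ I J J′ → I ℤ.+ J′ ≡ (((I - J) ℤ.+ + 1) ℤ.+ (J ℤ.+ J′)) - + 1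
  identity = solve-∀
  identity′ : ∀ I′ J J′ → (((I′ - J′) ℤ.+ + 1) ℤ.+ (J ℤ.+ J′)) - + 1 ≡ I′ ℤ.+ J
  identity′ = solve-∀

cellDiagonal-≡⇐ : ∀ {i j i′ j′} → i + j′ ≡ i′ + j → cellDiagonal (i , j) ≡ cellDiagonal (i′ , j′)
cellDiagonal-≡⇐ {i} {j} {i′} {j′} eq = begin
  cellDiagonal (i , j)                           ≡⟨ identity (+ i) (+ j) (+ j′) ⟩
  ((+ i ℤ.+ + j′) - (+ j ℤ.+ + j′)) ℤ.+ + 1      ≡⟨ cong (λ S → (S - (+ j ℤ.+ + j′)) ℤ.+ + 1) (sym (pos-+ i j′)) ⟩
  (+ (i + j′) - (+ j ℤ.+ + j′)) ℤ.+ + 1          ≡⟨ cong (λ S → (+ S - (+ j ℤ.+ + j′)) ℤ.+ + 1) eq ⟩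
  (+ (i′ + j) - (+ j ℤ.+ + j′)) ℤ.+ + 1          ≡⟨ cong (λ S → (S - (+ j ℤ.+ + j′)) ℤ.+ + 1) (pos-+ i′ j) ⟩
  ((+ i′ ℤ.+ + j) - (+ j ℤ.+ + j′)) ℤ.+ + 1      ≡⟨ identity′ (+ i′) (+ j) (+ j′) ⟩
  cellDiagonal (i′ , j′) ∎
  where
  open ≡-Reasoning
  identity : ∀ I J J′ → (I - J) ℤ.+ + 1 ≡ ((I ℤ.+ J′) - (J ℤ.+ J′)) ℤ.+ + 1
  identity = solve-∀
  identity′ : ∀ I′ J J′ → ((I′ ℤ.+ J) - (J ℤ.+ J′)) ℤ.+ + 1 ≡ (I′ - J′) ℤ.+ + 1
  identity′ = solve-∀

cellDiagonal-shift : ∀ x {y} → 1 ≤ y → cellDiagonal (x , y ∸ 1) ≡ cellDiagonal (suc x , y)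
cellDiagonal-shift x {suc y} _ = cellDiagonal-≡⇐ {x} {y} {suc x} {suc y} (+-suc x y)

rowDiagonal-≡⇒offset : ∀ g r h r′ → rowDiagonal g r ≡ rowDiagonal h r′ → + r - + g r ≡ + r′ - + h r′
rowDiagonal-≡⇒offset g r h r′ eq = trans (identity (+ r - + g r)) (trans (cong (_- + 1) eq) (sym (identity (+ r′ - + h r′))))
  where
  identity : ∀ X → X ≡ (X ℤ.+ + 1) - + 1
  identity = solve-∀

minus-zero : ∀ n → + n - + 0 ≡ + n
minus-zero n = cong +_ (+-identityʳ n)

not-onDiag-empty-row : ∀ {f r i j} → f r ≡ 0 → OnDiag (rowDiagonal f r) (i , j) → 1 ≤ j → i ≤ r → ⊥
not-onDiag-empty-row {f} {r} {i} {j} fr≡0 on 1≤j i≤r =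
  <-irrefl (trans (sym (+-identityʳ i)) r+j≡i+0) (≤-<-trans i≤r (m<m+n r 1≤j))
  where
  r+j≡i+0 : i + 0 ≡ r + j
  r+j≡i+0 = sym (cellDiagonal-≡⇒ {r} {0} {i} {j} (trans (cong (λ m → cellDiagonal (r , m)) (sym fr≡0)) (onDiag⇒cellDiagonal on)))

module _ {f : ℕ → ℕ} (step-antitone : ∀ i → f (suc (suc i)) ≤ f (suc i)) where

  -- r ↦ r - f r is strictly increasing on the rows of a shape.
  rowDiagonal-injective : ∀ {r r′} → 1 ≤ r → 1 ≤ r′ → rowDiagonal f r ≡ rowDiagonal f r′ → r ≡ r′
  rowDiagonal-injective {r} {r′} 1≤r 1≤r′ eq with <-cmp r r′ | cellDiagonal-≡⇒ {r} {f r} {r′} {f r′} eq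
  ... | tri≈ _ r≡r′ _ | _ = r≡r′
  ... | tri< r<r′ _ _ | eq′ = contradiction eq′ (<⇒≢ (+-mono-<-≤ r<r′ (antitone step-antitone 1≤r (<⇒≤ r<r′))))
  ... | tri> _ _ r′<r | eq′ = contradiction (sym eq′) (<⇒≢ (+-mono-<-≤ r′<r (antitone step-antitone 1≤r′ (<⇒≤ r′<r))))

initial-unique : ∀ {H c c′} → IsInitial H c → IsInitial H c′ → c ≡ c′
initial-unique {c = i , j} {i′ , j′} (c∈H , c-ne) (c′∈H , c′-ne) =
  cong₂ _,_ (≤-antisym (proj₁ (c-ne i′ j′ c′∈H)) (proj₁ (c′-ne i j c∈H)))
            (≤-antisym (proj₂ (c′-ne i j c∈H)) (proj₂ (c-ne i′ j′ c′∈H)))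

terminal-unique : ∀ {H c c′} → IsTerminal H c → IsTerminal H c′ → c ≡ c′
terminal-unique {c = i , j} {i′ , j′} (c∈H , c-sw) (c′∈H , c′-sw) =
  cong₂ _,_ (≤-antisym (proj₁ (c′-sw i j c∈H)) (proj₁ (c-sw i′ j′ c′∈H)))
            (≤-antisym (proj₂ (c-sw i′ j′ c′∈H)) (proj₂ (c′-sw i j c∈H)))

HasInitialOn : List (List Cell) → ℤ → Set
HasInitialOn R d = Σ[ H ∈ List Cell ] Σ[ c ∈ Cell ] H ∈ R × IsInitial H c × OnDiag d c

-- IsPermSRT (length μ) (part μ) is PermSRT μ up to unfolding; row r of the paper is the index i with r = rowOf i.
rowOf : ∀ {L} → Fin L → ℕ
rowOf i = suc (toℕ i)

module _ (L : ℕ) (f : ℕ → ℕ) (R : List (List Cell)) (σ : Fin L → Fin L) (i : Fin L) where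

  NoInitialClause : Set
  NoInitialClause = ¬ HasInitialOn R (rowDiagonal f (rowOf i)) → + rowOf (σ i) ≡ + rowOf i - + f (rowOf i)

  InitialClause : Set
  InitialClause = ∀ H c t → H ∈ R → IsInitial H c → OnDiag (rowDiagonal f (rowOf i)) c → IsTerminal H t → + rowOf (σ i) ≡ + proj₁ t

  IsPermSRT-at : Set
  IsPermSRT-at = NoInitialClause × InitialClause

IsPermSRT : (L : ℕ) (f : ℕ → ℕ) → List (List Cell) → (Fin L → Fin L) → Set
IsPermSRT L f R σ = ∀ i → IsPermSRT-at L f R σ i

IsPermSRT-cong : ∀ {L f R} {σ τ : Fin L → Fin L} → (∀ i → σ i ≡ τ i) → IsPermSRT L f R σ → IsPermSRT L f R τ
IsPermSRT-cong {σ = σ} σ≗τ P i =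
  (λ no-initial → subst (λ x → + suc (toℕ x) ≡ _) (σ≗τ i) (proj₁ (P i) no-initial)) ,
  (λ G c t G∈R c-initial c-on t-terminal → subst (λ x → + suc (toℕ x) ≡ _) (σ≗τ i) (proj₂ (P i) G c t G∈R c-initial c-on t-terminal))

InitialsOnRowDiagonals : ℕ → (ℕ → ℕ) → List (List Cell) → Set
InitialsOnRowDiagonals L f R = ∀ {H c} → H ∈ R → IsInitial H c → Σ[ r ∈ ℕ ] 1 ≤ r × r ≤ L × 1 ≤ f r × OnDiag (rowDiagonal f r) c

-- The shape left after removing the rim hook that runs along the boundary from row A + 1 down.
removeRim : ℕ → (ℕ → ℕ) → ℕ → ℕ
removeRim A f i with i ≤? A
... | yes _ = f i
... | no _ = f (suc i) ∸ 1

module _ {A : ℕ} {f : ℕ → ℕ} where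

  removeRim-≤ : ∀ {i} → i ≤ A → removeRim A f i ≡ f i
  removeRim-≤ {i} i≤A with i ≤? A
  ... | yes _ = refl
  ... | no i≰A = contradiction i≤A i≰A

  removeRim-> : ∀ {i} → A < i → removeRim A f i ≡ f (suc i) ∸ 1
  removeRim-> {i} A<i with i ≤? A
  ... | yes i≤A = contradiction i≤A (<⇒≱ A<i)
  ... | no _ = refl

record LastRow (L : ℕ) (f : ℕ → ℕ) : Set where
  field
    ℓ : ℕ
    1≤ℓ : 1 ≤ ℓ
    ℓ≤L : ℓ ≤ L
    1≤fℓ : 1 ≤ f ℓ
    fℓ+1≡0 : f (suc ℓ) ≡ 0

lastRow : ∀ {L f} → Shape L f → 1 ≤ f 1 → LastRow L f
lastRow {L} {f} shape 1≤f1 = go L ≤-refl (Shape.vanishes shape ≤-refl)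
  where
  go : ∀ m → m ≤ L → f (suc m) ≡ 0 → LastRow L f
  go zero _ f1≡0 = contradiction (≤-trans 1≤f1 (≤-reflexive f1≡0)) λ ()
  go (suc m) m+1≤L fm+2≡0 with f (suc m) ℕ.≟ 0
  ... | yes fm+1≡0 = go m (≤-trans (n≤1+n m) m+1≤L) fm+1≡0
  ... | no fm+1≢0 = record { ℓ = suc m ; 1≤ℓ = s≤s z≤n ; ℓ≤L = m+1≤L ; 1≤fℓ = n≢0⇒n>0 fm+1≢0 ; fℓ+1≡0 = fm+2≡0 }

module BottomHook {L : ℕ} {f : ℕ → ℕ} (shape : Shape L f) {R : List (List Cell)} (T : IsTableau L f R)
                  (last : LastRow L f) where

  open Shape shape
  open IsTableau T
  open LastRow last public

  k : Fin (length R)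
  k = proj₁ (covers (ℓ , 1) (1≤ℓ , ℓ≤L , ≤-refl , 1≤fℓ))

  H : List Cell
  H = lookup R k

  ℓ1∈H : (ℓ , 1) ∈ H
  ℓ1∈H = proj₂ (covers (ℓ , 1) (1≤ℓ , ℓ≤L , ≤-refl , 1≤fℓ))

  f-antitone : ∀ {i i′} → 1 ≤ i → i ≤ i′ → f i′ ≤ f i
  f-antitone = antitone step-antitone

  hook-inShape : ∀ {G c} → G ∈ R → c ∈ G → InShape L f c
  hook-inShape G∈R c∈G = All.lookup inShape G∈R _ c∈G

  rimHook-at : ∀ k′ → IsRimHook (lookup R k′)
  rimHook-at k′ = All.lookup rimHooks (∈-lookup k′)

  convex-at : ∀ k′ → IsConvex (lookup R k′)
  convex-at k′ = skew⇒convex (proj₁ (rimHook-at k′))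

  connected-at : ∀ k′ → Connected (lookup R k′)
  connected-at k′ = proj₁ (proj₂ (rimHook-at k′))

  H-inShape : ∀ {c} → c ∈ H → InShape L f c
  H-inShape = hook-inShape (∈-lookup k)

  first-column-at : ∀ k′ → Σ[ g ∈ ℕ ] (g , 1) ∈ lookup R k′
  first-column-at k′ = All.lookup meetFirstColumn (∈-lookup k′)

  row-empty : ∀ {i} → ℓ < i → f i ≡ 0
  row-empty ℓ<i = n≤0⇒n≡0 (≤-trans (f-antitone (s≤s z≤n) ℓ<i) (≤-reflexive fℓ+1≡0))

  nonempty-row-≤ℓ : ∀ {i} → 1 ≤ f i → i ≤ ℓ
  nonempty-row-≤ℓ {i} 1≤fi with i ≤? ℓ
  ... | yes i≤ℓ = i≤ℓ
  ... | no i≰ℓ = contradiction (≤-trans 1≤fi (≤-reflexive (row-empty (≰⇒> i≰ℓ)))) λ ()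

  row-≤ℓ : ∀ {i j} → InShape L f (i , j) → i ≤ ℓ
  row-≤ℓ (_ , _ , 1≤j , j≤fi) = nonempty-row-≤ℓ (≤-trans 1≤j j≤fi)

  rows-≤ℓ-nonempty : ∀ {i} → 1 ≤ i → i ≤ ℓ → 1 ≤ f i
  rows-≤ℓ-nonempty 1≤i i≤ℓ = ≤-trans 1≤fℓ (f-antitone 1≤i i≤ℓ)

  H-columns : ∀ {s c} → (s , c) ∈ H → 1 ≤ c
  H-columns sc∈H = proj₁ (proj₂ (proj₂ (H-inShape sc∈H)))

  south-east-closed : ∀ {s c r d} → (s , c) ∈ H → InShape L f (r , d) → s ≤ r → c ≤ d → (r , d) ∈ H
  south-east-closed {s} {c} {r} {d} sc∈H rd-in s≤r c≤d with covers (r , d) rd-in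
  ... | k′ , rd∈G with k′ Fin.≟ k
  ...   | yes refl = rd∈G
  ...   | no k′≢k = ⊥-elim (no-southeast (convex-at k) (convex-at k′) (connected-at k) (connected-at k′)
                                         (λ c∈H c∈G → k′≢k (disjoint _ k′ k c∈G c∈H))
                                         ℓ1∈H (proj₂ (first-column-at k′))
                                         (λ c∈G → row-≤ℓ (hook-inShape (∈-lookup k′) c∈G)) H-columns
                                         sc∈H rd∈G s≤r c≤d)

  top : Cell
  top = argmin proj₁ (ℓ , 1) H

  top∈H : top ∈ H
  top∈H = argmin-all proj₁ ℓ1∈H (All.tabulate id)

  a : ℕ
  a = proj₁ top

  a-minimal : ∀ {i j} → (i , j) ∈ H → a ≤ i
  a-minimal ij∈H = All.lookup (f[argmin]≤f[xs] (ℓ , 1) H) ij∈H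

  1≤a : 1 ≤ a
  1≤a = proj₁ (H-inShape top∈H)

  a≤ℓ : a ≤ ℓ
  a≤ℓ = row-≤ℓ (H-inShape top∈H)

  -- Rows are numbered from 1 and their indices in Fin L from 0: row a has index A, and row ℓ index E below.
  A : ℕ
  A = pred a

  a≡1+A : a ≡ suc A
  a≡1+A = sym (suc-pred a ⦃ ℕ.>-nonZero 1≤a ⦄)

  -- H is the outer rim of rows a, …, ℓ: the cells (i , j) with a ≤ i ≤ ℓ and f (i + 1) ≤ j ≤ f i.
  H-cell⇒ : ∀ {i j} → (i , j) ∈ H → f (suc i) ≤ j
  H-cell⇒ {i} {j} ij∈H with f (suc i) ≤? j
  ... | yes fi+1≤j = fi+1≤j
  ... | no fi+1≰j = contradiction (ij∈H , below∈H , right∈H , diagonal∈H) (proj₂ (proj₂ (rimHook-at k)) i j)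
    where
    j<fi+1 = ≰⇒> fi+1≰j
    1≤i = proj₁ (H-inShape ij∈H)
    i≤L = proj₁ (proj₂ (H-inShape ij∈H))
    1≤j = H-columns ij∈H
    i+1≤L = ≤-trans (nonempty-row-≤ℓ (≤-trans (s≤s z≤n) j<fi+1)) ℓ≤L
    below∈H = south-east-closed ij∈H (s≤s z≤n , i+1≤L , 1≤j , <⇒≤ j<fi+1) (n≤1+n i) ≤-refl
    right∈H = south-east-closed ij∈H (1≤i , i≤L , s≤s z≤n , ≤-trans j<fi+1 (f-antitone 1≤i (n≤1+n i))) ≤-refl (n≤1+n j)
    diagonal∈H = south-east-closed ij∈H (s≤s z≤n , i+1≤L , s≤s z≤n , j<fi+1) (n≤1+n i) (n≤1+n j)

  H-cell⇐ : ∀ {i j} → InShape L f (i , j) → a ≤ i → f (suc i) ≤ j → (i , j) ∈ H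
  H-cell⇐ {i} {j} ij-in a≤i fi+1≤j with i <? ℓ
  ... | no i≮ℓ = south-east-closed ℓ1∈H ij-in (≮⇒≥ i≮ℓ) (proj₁ (proj₂ (proj₂ ij-in)))
  ... | yes i<ℓ with reach-crosses-row (connected-at k top (ℓ , 1) top∈H ℓ1∈H) i a≤i i<ℓ
  ...   | t , it∈H , i+1t∈H =
    south-east-closed it∈H ij-in ≤-refl (≤-trans (proj₂ (proj₂ (proj₂ (H-inShape i+1t∈H)))) fi+1≤j)

  H-rows : ∀ {i j} → (i , j) ∈ H → a ≤ i × i ≤ ℓ
  H-rows ij∈H = a-minimal ij∈H , row-≤ℓ (H-inShape ij∈H)

  rim-end∈H : ∀ {i} → a ≤ i → i ≤ ℓ → (i , f i) ∈ H
  rim-end∈H {i} a≤i i≤ℓ =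
    H-cell⇐ (1≤i , ≤-trans i≤ℓ ℓ≤L , rows-≤ℓ-nonempty 1≤i i≤ℓ , ≤-refl) a≤i (f-antitone 1≤i (n≤1+n i))
    where 1≤i = ≤-trans 1≤a a≤i

  H-initial : IsInitial H (a , f a)
  H-initial = rim-end∈H ≤-refl a≤ℓ ,
              λ i j ij∈H → a-minimal ij∈H , ≤-trans (proj₂ (proj₂ (proj₂ (H-inShape ij∈H)))) (f-antitone 1≤a (a-minimal ij∈H))

  H-terminal : IsTerminal H (ℓ , 1)
  H-terminal = ℓ1∈H , λ i j ij∈H → row-≤ℓ (H-inShape ij∈H) , H-columns ij∈H

  f′ : ℕ → ℕ
  f′ = removeRim A f

  A<ℓ : A < ℓ
  A<ℓ = subst (_≤ ℓ) a≡1+A a≤ℓ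

  a≤⇒A< : ∀ {i} → a ≤ i → A < i
  a≤⇒A< = subst (_≤ _) a≡1+A

  f′-vanishes-from-ℓ : ∀ {i} → ℓ ≤ i → f′ i ≡ 0
  f′-vanishes-from-ℓ ℓ≤i = trans (removeRim-> (<-≤-trans A<ℓ ℓ≤i)) (cong (_∸ 1) (row-empty (s≤s ℓ≤i)))

  shape′ : Shape L f′
  shape′ = record
    { step-antitone = step-antitone′
    ; vanishes = λ L<i → f′-vanishes-from-ℓ (≤-trans ℓ≤L (<⇒≤ L<i))
    }
    where
    step-antitone′ : ∀ i → f′ (suc (suc i)) ≤ f′ (suc i)
    step-antitone′ i with suc (suc i) ≤? A | suc i ≤? A
    ... | yes _ | yes _ = step-antitone i
    ... | yes i+2≤A | no i+1≰A = contradiction (≤-trans (n≤1+n _) i+2≤A) i+1≰A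
    ... | no _ | yes _ = ≤-trans (m∸n≤m _ 1) (≤-trans (step-antitone (suc i)) (step-antitone i))
    ... | no _ | no _ = ∸-monoˡ-≤ 1 (step-antitone (suc i))

  H-outside-shape′ : ∀ {i j} → (i , j) ∈ H → ¬ InShape L f′ (i , j)
  H-outside-shape′ {i} {j} ij∈H (_ , _ , 1≤j , j≤f′i) =
    <-irrefl refl (m≤pred[n]⇒suc[m]≤n ⦃ ℕ.>-nonZero 1≤j ⦄ j≤j-1)
    where
    j≤j-1 : j ≤ pred j
    j≤j-1 = ≤-trans j≤f′i (≤-trans (≤-reflexive (removeRim-> (a≤⇒A< (a-minimal ij∈H)))) (pred-mono-≤ (H-cell⇒ ij∈H)))

  shape∖H⊆shape′ : ∀ {i j} → InShape L f (i , j) → (i , j) ∉ H → InShape L f′ (i , j)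
  shape∖H⊆shape′ {i} {j} (1≤i , i≤L , 1≤j , j≤fi) ij∉H with i ≤? A
  ... | yes _ = 1≤i , i≤L , 1≤j , j≤fi
  ... | no i≰A with f (suc i) ≤? j
  ...   | yes fi+1≤j = contradiction (H-cell⇐ (1≤i , i≤L , 1≤j , j≤fi) (subst (_≤ i) (sym a≡1+A) (≰⇒> i≰A)) fi+1≤j) ij∉H
  ...   | no fi+1≰j = 1≤i , i≤L , 1≤j , <⇒≤pred (≰⇒> fi+1≰j)

  shape′⊆shape : ∀ {i j} → InShape L f′ (i , j) → InShape L f (i , j)
  shape′⊆shape {i} {j} (1≤i , i≤L , 1≤j , j≤f′i) with i ≤? A
  ... | yes _ = 1≤i , i≤L , 1≤j , j≤f′i
  ... | no _ = 1≤i , i≤L , 1≤j , ≤-trans j≤f′i (≤-trans (m∸n≤m _ 1) (f-antitone 1≤i (n≤1+n i)))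

  R′ : List (List Cell)
  R′ = removeAt R k

  in-R′⇒in-R : ∀ j {c} → c ∈ lookup R′ j → c ∈ lookup R (skipIndex R k j)
  in-R′⇒in-R j = subst (_ ∈_) (lookup-removeAt R k j)

  in-R′⇒∉H : ∀ j {c} → c ∈ lookup R′ j → c ∉ H
  in-R′⇒∉H j c∈G c∈H = skipIndex-≢ R k j (disjoint _ _ k (in-R′⇒in-R j c∈G) c∈H)

  R′⊆R : ∀ {G} → G ∈ R′ → G ∈ R
  R′⊆R = ∈-removeAt⁻ R k

  R-split : ∀ {G} → G ∈ R → G ≡ H ⊎ G ∈ R′
  R-split = ∈-removeAt-split R k

  tableau′ : IsTableau L f′ R′
  tableau′ = record
    { rimHooks = All.tabulate (All.lookup rimHooks ∘ R′⊆R)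
    ; meetFirstColumn = All.tabulate (All.lookup meetFirstColumn ∘ R′⊆R)
    ; inShape = All.tabulate inShape′
    ; covers = covers′
    ; disjoint = λ c j j′ c∈ c∈′ → skipIndex-injective R k (disjoint c _ _ (in-R′⇒in-R j c∈) (in-R′⇒in-R j′ c∈′))
    }
    where
    inShape′ : ∀ {G} → G ∈ R′ → ∀ c → c ∈ G → InShape L f′ c
    inShape′ G∈R′ (i , j) c∈G =
      shape∖H⊆shape′ (hook-inShape (R′⊆R G∈R′) c∈G) (in-R′⇒∉H (index G∈R′) (subst (_ ∈_) (lookup-index G∈R′) c∈G))
    covers′ : ∀ c → InShape L f′ c → Σ[ j ∈ Fin (length R′) ] c ∈ lookup R′ j
    covers′ (i , j) c-in′ with covers (i , j) (shape′⊆shape c-in′)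
    ... | k′ , c∈G with k′ Fin.≟ k
    ...   | yes refl = contradiction c-in′ (H-outside-shape′ c∈G)
    ...   | no k′≢k with j′ , refl ← skipIndex-surjective R k k′ k′≢k =
      j′ , subst (_ ∈_) (sym (lookup-removeAt R k j′)) c∈G

module BottomHookPerm {L : ℕ} {f : ℕ → ℕ} (shape : Shape L f) {R : List (List Cell)} (T : IsTableau L f R)
                      (last : LastRow L f) where

  open BottomHook shape T last public
  open Shape shape

  E : ℕ
  E = pred ℓ

  ℓ≡1+E : ℓ ≡ suc E
  ℓ≡1+E = sym (suc-pred ℓ ⦃ ℕ.>-nonZero 1≤ℓ ⦄)

  A≤E : A ≤ E
  A≤E = ≤-pred (subst (suc A ≤_) ℓ≡1+E A<ℓ)

  E<L : E < L
  E<L = subst (_≤ L) ℓ≡1+E ℓ≤L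

  open Rotation A≤E E<L public

  a-index : Fin L
  a-index = Fin.fromℕ< (≤-<-trans A≤E E<L)

  toℕ-a-index : toℕ a-index ≡ A
  toℕ-a-index = Finₚ.toℕ-fromℕ< _

  nonempty-row′-<ℓ : ∀ {i} → 1 ≤ f′ i → i < ℓ
  nonempty-row′-<ℓ {i} 1≤f′i with i <? ℓ
  ... | yes i<ℓ = i<ℓ
  ... | no i≮ℓ = contradiction (≤-trans 1≤f′i (≤-reflexive (f′-vanishes-from-ℓ (≮⇒≥ i≮ℓ)))) λ ()

  no-initial-on-row-ℓ′ : ¬ HasInitialOn R′ (rowDiagonal f′ ℓ)
  no-initial-on-row-ℓ′ (G , (i , j) , G∈R′ , c-initial , c-on) =
    not-onDiag-empty-row {f′} (f′-vanishes-from-ℓ ≤-refl) c-on 1≤j (<⇒≤ (nonempty-row′-<ℓ (≤-trans 1≤j j≤f′i)))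
    where
    c-in = All.lookup (IsTableau.inShape tableau′) G∈R′ _ (proj₁ c-initial)
    1≤j = proj₁ (proj₂ (proj₂ c-in))
    j≤f′i = proj₂ (proj₂ (proj₂ c-in))

  no-initial-below-ℓ : ∀ {z} → ℓ ≤ z → ¬ HasInitialOn R (rowDiagonal f (suc z))
  no-initial-below-ℓ ℓ≤z (G , (i , j) , G∈R , c-initial , c-on) =
    not-onDiag-empty-row {f} (row-empty (s≤s ℓ≤z)) c-on (proj₁ (proj₂ (proj₂ c-in))) (≤-trans (row-≤ℓ c-in) (≤-trans ℓ≤z (n≤1+n _)))
    where c-in = hook-inShape G∈R (proj₁ c-initial)

  H-initial-on-row-a : OnDiag (rowDiagonal f a) (a , f a)
  H-initial-on-row-a = onDiag-cellDiagonal a (f a)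

  H-initial-only-on-row-a : ∀ x → OnDiag (rowDiagonal f (suc x)) (a , f a) → x ≡ A
  H-initial-only-on-row-a x on = suc-injective (trans (rowDiagonal-injective {f} step-antitone (s≤s z≤n) 1≤a (onDiag⇒cellDiagonal on)) a≡1+A)

  row′⇒row : ∀ {r′} → 1 ≤ r′ → r′ ≤ L → 1 ≤ f′ r′ →
             Σ[ r ∈ ℕ ] 1 ≤ r × r ≤ L × 1 ≤ f r × r ≢ a × rowDiagonal f′ r′ ≡ rowDiagonal f r
  row′⇒row {r′} 1≤r′ r′≤L 1≤f′r′ with r′ ≤? A
  ... | yes r′≤A = r′ , 1≤r′ , r′≤L , 1≤f′r′ , (λ r′≡a → <-irrefl (trans r′≡a a≡1+A) (s≤s r′≤A)) , refl
  ... | no r′≰A = suc r′ , s≤s z≤n , ≤-trans (nonempty-row-≤ℓ 1≤fr′+1) ℓ≤L , 1≤fr′+1 ,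
                  (λ r′+1≡a → <-irrefl (sym (trans r′+1≡a a≡1+A)) (s≤s (≰⇒> r′≰A))) , cellDiagonal-shift r′ 1≤fr′+1
    where
    1≤fr′+1 : 1 ≤ f (suc r′)
    1≤fr′+1 = ≤-trans 1≤f′r′ (m∸n≤m _ 1)

  initials-on-row-diagonals-step : InitialsOnRowDiagonals L f′ R′ → InitialsOnRowDiagonals L f R
  initials-on-row-diagonals-step D′ G∈R c-initial with R-split G∈R
  ... | inj₁ refl = a , 1≤a , ≤-trans a≤ℓ ℓ≤L , rows-≤ℓ-nonempty 1≤a a≤ℓ ,
                    subst (OnDiag (rowDiagonal f a)) (initial-unique H-initial c-initial) H-initial-on-row-a
  ... | inj₂ G∈R′ with D′ G∈R′ c-initial
  ...   | r′ , 1≤r′ , r′≤L , 1≤f′r′ , on′ with row′⇒row 1≤r′ r′≤L 1≤f′r′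
  ...     | r , 1≤r , r≤L , 1≤fr , _ , eq = r , 1≤r , r≤L , 1≤fr , subst (λ d → OnDiag d _) eq on′

  R′-initials-off-row-a : InitialsOnRowDiagonals L f′ R′ → ∀ {G c} → G ∈ R′ → IsInitial G c → ¬ OnDiag (rowDiagonal f a) c
  R′-initials-off-row-a D′ G∈R′ c-initial on
    with D′ G∈R′ c-initial
  ... | r′ , 1≤r′ , r′≤L , 1≤f′r′ , on′ with row′⇒row 1≤r′ r′≤L 1≤f′r′
  ...   | r , 1≤r , _ , _ , r≢a , eq =
    r≢a (rowDiagonal-injective {f} step-antitone 1≤r 1≤a (trans (sym eq) (trans (onDiag⇒cellDiagonal on′) (sym (onDiag⇒cellDiagonal on)))))

  -- Moving row x + 1 up to row x and shortening it by one keeps its diagonal.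
  rowDiagonal-rotate : ∀ x → x ≢ A → rowDiagonal f′ (suc (rotate A E x)) ≡ rowDiagonal f (suc x)
  rowDiagonal-rotate x x≢A with region {A} {E} x
  ... | below x<A rewrite rotate-below {A} {E} x<A = cong (λ m → cellDiagonal (suc x , m)) (removeRim-≤ x<A)
  ... | start = contradiction refl x≢A
  ... | inside {y} A≤y y<E rewrite rotate-inside {A} {E} A≤y y<E =
    trans (cong (λ m → cellDiagonal (suc y , m)) (removeRim-> (s≤s A≤y)))
          (cellDiagonal-shift (suc y) (rows-≤ℓ-nonempty (s≤s z≤n) (subst (suc (suc y) ≤_) (sym ℓ≡1+E) (s≤s y<E))))
  ... | above E<x rewrite rotate-above A≤E E<x =
    cong (λ m → cellDiagonal (suc x , m)) (trans (f′-vanishes-from-ℓ (<⇒≤ ℓ<1+x)) (sym (row-empty ℓ<1+x)))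
    where
    ℓ<1+x : ℓ < suc x
    ℓ<1+x = subst (_< suc x) (sym ℓ≡1+E) (s≤s E<x)

  H-initial-on-row : ∀ {i : Fin L} → toℕ i ≡ A → OnDiag (rowDiagonal f (rowOf i)) (a , f a)
  H-initial-on-row i≡A = subst (λ r → OnDiag (rowDiagonal f r) (a , f a)) (trans a≡1+A (cong suc (sym i≡A))) H-initial-on-row-a

  perm-at-a : ∀ {σ} → IsPermSRT L f R σ → ∀ {i} → toℕ i ≡ A → toℕ (σ i) ≡ E
  perm-at-a P {i} i≡A =
    suc-injective (+-injective (trans (proj₂ (P i) H (a , f a) (ℓ , 1) (∈-lookup k) H-initial (H-initial-on-row i≡A) H-terminal)
                                      (cong +_ ℓ≡1+E)))

  perm-fixes-below : ∀ {σ} → IsPermSRT L f R σ → ∀ {z} → E < toℕ z → toℕ (σ z) ≡ toℕ z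
  perm-fixes-below P {z} E<z =
    suc-injective (+-injective (trans (proj₁ (P z) (no-initial-below-ℓ ℓ≤z))
                                      (trans (cong (λ m → + rowOf z - + m) (row-empty (s≤s ℓ≤z))) (minus-zero (rowOf z)))))
    where
    ℓ≤z : ℓ ≤ toℕ z
    ℓ≤z = subst (_≤ toℕ z) (sym ℓ≡1+E) E<z

  row-ℓ′-value : ∀ {σ′ : Fin L → Fin L} {i} → IsPermSRT L f′ R′ σ′ → rowOf i ≡ ℓ → + rowOf (σ′ i) ≡ + ℓ
  row-ℓ′-value {σ′} {i} P′ i≡ℓ = begin
    + rowOf (σ′ i)               ≡⟨ proj₁ (P′ i) (subst (λ r → ¬ HasInitialOn R′ (rowDiagonal f′ r)) (sym i≡ℓ) no-initial-on-row-ℓ′) ⟩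
    + rowOf i - + f′ (rowOf i)   ≡⟨ cong (λ r → + r - + f′ r) i≡ℓ ⟩
    + ℓ - + f′ ℓ                 ≡⟨ cong (λ m → + ℓ - + m) (f′-vanishes-from-ℓ ≤-refl) ⟩
    + ℓ - + 0                    ≡⟨ minus-zero ℓ ⟩
    + ℓ ∎
    where open ≡-Reasoning

  module _ {σ′ : Fin L → Fin L} (D′ : InitialsOnRowDiagonals L f′ R′) (P′ : IsPermSRT L f′ R′ σ′) where

    private
      -- Row a carries the initial cell of H, and ℓ, the image of row a, is the terminal row of H.
      lift-at-a : ∀ i → toℕ i ≡ A → IsPermSRT-at L f R (σ′ ∘ rotateF) i
      lift-at-a i i≡A = (λ no-initial → contradiction (H , (a , f a) , ∈-lookup k , H-initial , H-initial-on-row i≡A) no-initial) ,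
                        clause₂
        where
        clause₂ : InitialClause L f R (σ′ ∘ rotateF) i
        clause₂ G c t G∈R c-initial c-on t-terminal with R-split G∈R
        ... | inj₁ refl = trans (row-ℓ′-value P′ (trans (cong suc (rotateF-start i≡A)) (sym ℓ≡1+E)))
                                (cong (+_ ∘ proj₁) (terminal-unique H-terminal t-terminal))
        ... | inj₂ G∈R′ = ⊥-elim (R′-initials-off-row-a D′ G∈R′ c-initial
                                   (subst (λ r → OnDiag (rowDiagonal f r) c) (trans (cong suc i≡A) (sym a≡1+A)) c-on))

      lift-off-a : ∀ i → toℕ i ≢ A → IsPermSRT-at L f R (σ′ ∘ rotateF) i
      lift-off-a i i≢A = clause₁ , clause₂
        where
        same-diagonal : rowDiagonal f′ (rowOf (rotateF i)) ≡ rowDiagonal f (rowOf i)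
        same-diagonal = trans (cong (rowDiagonal f′ ∘ suc) (toℕ-rotateF i)) (rowDiagonal-rotate (toℕ i) i≢A)
        clause₁ : NoInitialClause L f R (σ′ ∘ rotateF) i
        clause₁ no-initial = trans (proj₁ (P′ (rotateF i)) no-initial′) (rowDiagonal-≡⇒offset f′ (rowOf (rotateF i)) f (rowOf i) same-diagonal)
          where
          no-initial′ : ¬ HasInitialOn R′ (rowDiagonal f′ (rowOf (rotateF i)))
          no-initial′ (G , c , G∈R′ , c-initial , c-on) =
            no-initial (G , c , R′⊆R G∈R′ , c-initial , subst (λ d → OnDiag d c) same-diagonal c-on)
        clause₂ : InitialClause L f R (σ′ ∘ rotateF) i
        clause₂ G c t G∈R c-initial c-on t-terminal with R-split G∈R
        ... | inj₁ refl = contradiction (H-initial-only-on-row-a (toℕ i)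
                                          (subst (OnDiag (rowDiagonal f (rowOf i))) (initial-unique c-initial H-initial) c-on)) i≢A
        ... | inj₂ G∈R′ = proj₂ (P′ (rotateF i)) G c t G∈R′ c-initial (subst (λ d → OnDiag d c) (sym same-diagonal) c-on) t-terminal

    perm-lift : IsPermSRT L f R (σ′ ∘ rotateF)
    perm-lift i = [ lift-at-a i , lift-off-a i ]′ (toSum (toℕ i ≟ A))

  module _ {σ : Fin L → Fin L} (P : IsPermSRT L f R σ) where

    private
      restrict-at-E : ∀ y → toℕ y ≡ E → IsPermSRT-at L f′ R′ (σ ∘ unrotateF) y
      restrict-at-E y y≡E = clause₁ , clause₂
        where
        y≡ℓ : rowOf y ≡ ℓ
        y≡ℓ = trans (cong suc y≡E) (sym ℓ≡1+E)
        uy≡A : toℕ (unrotateF y) ≡ A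
        uy≡A = trans (toℕ-unrotateF y) (trans (cong (unrotate A E) y≡E) (unrotate-end {A} {E}))
        clause₁ : NoInitialClause L f′ R′ (σ ∘ unrotateF) y
        clause₁ _ = begin
          + rowOf (σ (unrotateF y))    ≡⟨ cong (+_ ∘ suc) (perm-at-a P uy≡A) ⟩
          + suc E                      ≡⟨ cong +_ (sym ℓ≡1+E) ⟩
          + ℓ                          ≡⟨ minus-zero ℓ ⟨
          + ℓ - + 0                    ≡⟨ cong (λ m → + ℓ - + m) (f′-vanishes-from-ℓ ≤-refl) ⟨
          + ℓ - + f′ ℓ                 ≡⟨ cong (λ r → + r - + f′ r) y≡ℓ ⟨
          + rowOf y - + f′ (rowOf y) ∎
          where open ≡-Reasoning
        clause₂ : InitialClause L f′ R′ (σ ∘ unrotateF) y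
        clause₂ G c t G∈R′ c-initial c-on _ =
          ⊥-elim (no-initial-on-row-ℓ′ (G , c , G∈R′ , c-initial , subst (λ r → OnDiag (rowDiagonal f′ r) c) y≡ℓ c-on))

      restrict-off-E : ∀ y → toℕ y ≢ E → IsPermSRT-at L f′ R′ (σ ∘ unrotateF) y
      restrict-off-E y y≢E = clause₁ , clause₂
        where
        x = unrotateF y
        rotate-x : rotate A E (toℕ x) ≡ toℕ y
        rotate-x = trans (sym (toℕ-rotateF x)) (cong toℕ (rotateF-unrotateF y))
        x≢A : toℕ x ≢ A
        x≢A x≡A = y≢E (trans (sym rotate-x) (trans (cong (rotate A E) x≡A) (rotate-start {A} {E})))
        same-diagonal : rowDiagonal f′ (rowOf y) ≡ rowDiagonal f (rowOf x)
        same-diagonal = trans (cong (rowDiagonal f′ ∘ suc) (sym rotate-x)) (rowDiagonal-rotate (toℕ x) x≢A)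
        clause₁ : NoInitialClause L f′ R′ (σ ∘ unrotateF) y
        clause₁ no-initial′ = trans (proj₁ (P x) no-initial) (sym (rowDiagonal-≡⇒offset f′ (rowOf y) f (rowOf x) same-diagonal))
          where
          no-initial : ¬ HasInitialOn R (rowDiagonal f (rowOf x))
          no-initial (G , c , G∈R , c-initial , c-on) with R-split G∈R
          ... | inj₁ refl = x≢A (H-initial-only-on-row-a (toℕ x) (subst (OnDiag (rowDiagonal f (rowOf x))) (initial-unique c-initial H-initial) c-on))
          ... | inj₂ G∈R′ = no-initial′ (G , c , G∈R′ , c-initial , subst (λ d → OnDiag d c) (sym same-diagonal) c-on)
        clause₂ : InitialClause L f′ R′ (σ ∘ unrotateF) y
        clause₂ G c t G∈R′ c-initial c-on t-terminal =
          proj₂ (P x) G c t (R′⊆R G∈R′) c-initial (subst (λ d → OnDiag d c) same-diagonal c-on) t-terminal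

    perm-restrict : IsPermSRT L f′ R′ (σ ∘ unrotateF)
    perm-restrict y = [ restrict-at-E y , restrict-off-E y ]′ (toSum (toℕ y ≟ E))

module _ {L f} (shape : Shape L f) {R} (T : IsTableau L f R) (last : LastRow L f) where
  open BottomHookPerm shape T last

  rowsOccupied-H : rowsOccupied H ≡ ℓ ∸ A
  rowsOccupied-H = begin
    rowsOccupied H
      ≡⟨ cong (λ m → length (filter occupied? (upTo (suc m)))) maxRow-H ⟩
    length (filter occupied? (upTo (suc ℓ)))
      ≡⟨ length-filter-applyUpTo occupied? (suc ℓ) (λ i → i) ⟩
    sum {suc ℓ} (λ i → indicator (does (occupied? (toℕ i))))
      ≡⟨ sum-cong-≗ {suc ℓ} (λ i → cong indicator (does-⇔ (occupied⇔ (toℕ i)) (occupied? (toℕ i)) ((A <? toℕ i) ×-dec (toℕ i ≤? ℓ)))) ⟩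
    sum {suc ℓ} (λ i → indicator (does (A <? toℕ i) ∧ does (toℕ i ≤? ℓ)))
      ≡⟨ count-interval A ℓ ≤-refl ⟩
    ℓ ∸ A ∎
    where
    open ≡-Reasoning
    occupied? = λ i → anyRow i H Bool.≟ true
    maxRow-H : maxRow H ≡ ℓ
    maxRow-H = ≤-antisym (maxRow-least H (λ c∈H → proj₂ (H-rows c∈H))) (maxRow-upper ℓ1∈H)
    occupied⇔ : ∀ i → (anyRow i H ≡ true) ⇔ (A < i × i ≤ ℓ)
    occupied⇔ i = mk⇔ (λ found → let (j , ij∈H) = anyRow-sound i H found in a≤⇒A< (proj₁ (H-rows ij∈H)) , proj₂ (H-rows ij∈H))
                      (λ (A<i , i≤ℓ) → anyRow-complete H (rim-end∈H (subst (_≤ i) (sym a≡1+A) A<i) i≤ℓ))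

  module _ {σ : Fin L → Fin L} (σ-injective : Injective _≡_ _≡_ σ) (P : IsPermSRT L f R σ) where

    perm-below-E : ∀ {x} → A < toℕ x → toℕ x ≤ E → toℕ (σ x) < E
    perm-below-E {x} A<x x≤E with <-cmp (toℕ (σ x)) E
    ... | tri< σx<E _ _ = σx<E
    ... | tri≈ _ σx≡E _ = contradiction (trans (cong toℕ x≡a-index) toℕ-a-index) (>⇒≢ A<x)
      where
      x≡a-index : x ≡ a-index
      x≡a-index = σ-injective (Finₚ.toℕ-injective (trans σx≡E (sym (perm-at-a P toℕ-a-index))))
    ... | tri> _ _ E<σx = contradiction (subst (E <_) (cong toℕ σx≡x) E<σx) (≤⇒≯ x≤E)
      where
      σx≡x : σ x ≡ x
      σx≡x = σ-injective (Finₚ.toℕ-injective (perm-fixes-below P E<σx))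

    sign-step : sgnSRT R′ ≡ sgnOf (inversions (σ ∘ unrotateF)) → sgnSRT R ≡ sgnOf (inversions σ)
    sign-step ih = begin
      sgnSRT R                                   ≡⟨ cong sgnOf (sum-map-removeAt hookSign R k) ⟩
      sgnOf (hookSign H + hookSigns R′)          ≡⟨ cong (λ m → sgnOf (m + hookSigns R′)) hookSign-H ⟩
      sgnOf ((E ∸ A) + hookSigns R′)             ≡⟨ sgnOf-+ (E ∸ A) ih ⟩
      sgnOf ((E ∸ A) + inversions σ′)            ≡⟨ cong sgnOf (+-comm (E ∸ A) (inversions σ′)) ⟩
      sgnOf (inversions σ′ + (E ∸ A))            ≡⟨ cong sgnOf (inversions-∘-rotateF A≤E E<L σ′ σ′-max) ⟨
      sgnOf (inversions (σ′ ∘ rotateF))          ≡⟨ cong sgnOf (inversions-cong (λ i → cong σ (unrotateF-rotateF i))) ⟩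
      sgnOf (inversions σ) ∎
      where
      open ≡-Reasoning
      hookSign : List Cell → ℕ
      hookSign G = rowsOccupied G ∸ 1
      hookSigns : List (List Cell) → ℕ
      hookSigns = List.sum ∘ map hookSign
      σ′ = σ ∘ unrotateF
      hookSign-H : hookSign H ≡ E ∸ A
      hookSign-H = begin
        rowsOccupied H ∸ 1   ≡⟨ cong (_∸ 1) (trans rowsOccupied-H (cong (_∸ A) ℓ≡1+E)) ⟩
        suc E ∸ A ∸ 1        ≡⟨ cong (_∸ 1) (+-∸-assoc 1 A≤E) ⟩
        E ∸ A ∎
      σ′-max : ∀ p q → A ≤ toℕ p → toℕ p < E → toℕ q ≡ E → σ′ p Fin.< σ′ q
      σ′-max p q A≤p p<E q≡E = subst (toℕ (σ′ p) <_) (sym σ′q≡E) (perm-below-E A<up up≤E)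
        where
        up≡1+p : toℕ (unrotateF p) ≡ suc (toℕ p)
        up≡1+p = trans (toℕ-unrotateF p) (unrotate-inside A≤p p<E)
        A<up = subst (A <_) (sym up≡1+p) (s≤s A≤p)
        up≤E = subst (_≤ E) (sym up≡1+p) p<E
        σ′q≡E : toℕ (σ′ q) ≡ E
        σ′q≡E = perm-at-a P (trans (toℕ-unrotateF q) (trans (cong (unrotate A E) q≡E) (unrotate-end {A} {E})))

module _ {L f} (shape : Shape L f) {R R₂} (T : IsTableau L f R) (T₂ : IsTableau L f R₂) (last : LastRow L f) where
  private
    module B = BottomHookPerm shape T last
    module B₂ = BottomHookPerm shape T₂ last

  module _ {σ : Fin L → Fin L} (σ-injective : Injective _≡_ _≡_ σ) (P : IsPermSRT L f R σ) (P₂ : IsPermSRT L f R₂ σ) where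

    -- σ sends row a, and only row a, to the last row ℓ; so both tableaux have the same bottom hook.
    same-A : B.A ≡ B₂.A
    same-A = trans (sym B.toℕ-a-index) (trans (cong toℕ same-index) B₂.toℕ-a-index)
      where
      same-index : B.a-index ≡ B₂.a-index
      same-index = σ-injective (Finₚ.toℕ-injective (trans (B.perm-at-a P B.toℕ-a-index) (sym (B₂.perm-at-a P₂ B₂.toℕ-a-index))))

    same-H : SameHooks B.H B₂.H
    same-H (i , j) = (λ ij∈H → B₂.H-cell⇐ (B.H-inShape ij∈H) (subst (_≤ i) a≡a₂ (B.a-minimal ij∈H)) (B.H-cell⇒ ij∈H)) ,
                     (λ ij∈H₂ → B.H-cell⇐ (B₂.H-inShape ij∈H₂) (subst (_≤ i) (sym a≡a₂) (B₂.a-minimal ij∈H₂)) (B₂.H-cell⇒ ij∈H₂))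
      where
      a≡a₂ : B.a ≡ B₂.a
      a≡a₂ = trans B.a≡1+A (trans (cong suc same-A) (sym B₂.a≡1+A))

    tableau₂′ : IsTableau L B.f′ B₂.R′
    tableau₂′ = subst (λ X → IsTableau L (removeRim X f) B₂.R′) (sym same-A) B₂.tableau′

    perm₂′ : IsPermSRT L B.f′ B₂.R′ (σ ∘ B.unrotateF)
    perm₂′ = IsPermSRT-cong {L} {B.f′} {B₂.R′} (λ y → cong σ (same-unrotate y))
                            (subst (λ X → IsPermSRT L (removeRim X f) B₂.R′ (σ ∘ B₂.unrotateF)) (sym same-A) (B₂.perm-restrict P₂))
      where
      same-unrotate : ∀ y → B₂.unrotateF y ≡ B.unrotateF y
      same-unrotate y = Finₚ.toℕ-injective
        (trans (B₂.toℕ-unrotateF y) (trans (cong (λ X → unrotate X B.E (toℕ y)) (sym same-A)) (sym (B.toℕ-unrotateF y))))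

    injective-step : (∀ {R₂′ σ′} → IsTableau L B.f′ R₂′ → Injective _≡_ _≡_ σ′ →
                      IsPermSRT L B.f′ B.R′ σ′ → IsPermSRT L B.f′ R₂′ σ′ → SameSRT B.R′ R₂′) →
                     SameSRT R R₂
    injective-step ih =
      SameSRT-removeAt B.k B₂.k same-H (ih tableau₂′ (λ eq → B.unrotateF-injective (σ-injective eq)) (B.perm-restrict P) perm₂′)

module _ {L f} (shape : Shape L f) (T : IsTableau L f []) where

  empty-rows : ∀ {r} → 1 ≤ r → r ≤ L → f r ≡ 0
  empty-rows {r} 1≤r r≤L with f r ≟ 0
  ... | yes fr≡0 = fr≡0
  ... | no fr≢0 = contradiction (proj₁ (IsTableau.covers T (r , 1) (1≤r , r≤L , ≤-refl , n≢0⇒n>0 fr≢0))) Finₚ.¬Fin0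

  empty-perm-value : ∀ i → + rowOf i - + f (rowOf i) ≡ + rowOf i
  empty-perm-value i = trans (cong (λ m → + rowOf i - + m) (empty-rows (s≤s z≤n) (Finₚ.toℕ<n i))) (minus-zero (rowOf i))

  identity-perm : IsPermSRT L f [] (λ i → i)
  identity-perm i = (λ _ → sym (empty-perm-value i)) , (λ _ _ _ ())

  perm-on-empty : ∀ {σ} → IsPermSRT L f [] σ → ∀ i → σ i ≡ i
  perm-on-empty P i = Finₚ.toℕ-injective (suc-injective (+-injective (trans (proj₁ (P i) (λ ())) (empty-perm-value i))))

  no-hooks : ∀ {R₂} → IsTableau L f R₂ → ∀ {G} → G ∉ R₂
  no-hooks T₂ G∈R₂ with All.lookup (IsTableau.meetFirstColumn T₂) G∈R₂
  ... | i , i1∈G with All.lookup (IsTableau.inShape T₂) G∈R₂ (i , 1) i1∈G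
  ...   | 1≤i , i≤L , _ , 1≤fi = contradiction (≤-trans 1≤fi (≤-reflexive (empty-rows 1≤i i≤L))) λ ()

module _ {L : ℕ} (P : (ℕ → ℕ) → List (List Cell) → Set)
         (base : ∀ {f} → Shape L f → IsTableau L f [] → P f [])
         (step : ∀ {f R} (shape : Shape L f) (T : IsTableau L f R) (last : LastRow L f) →
                 P (BottomHook.f′ shape T last) (BottomHook.R′ shape T last) → P f R) where

  tableau-induction : ∀ {f R} → Shape L f → IsTableau L f R → P f R
  tableau-induction = go _ refl
    where
    go : ∀ n {f R} → length R ≡ n → Shape L f → IsTableau L f R → P f R
    go _ {R = []} _ shape T = base shape T
    go (suc n) {f} {G ∷ R} len shape T = step shape T last (go n len′ shape′ tableau′)
      where
      last : LastRow L f
      last with i , i1∈G ← All.lookup (IsTableau.meetFirstColumn T) (here refl)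
           with 1≤i , _ , _ , 1≤fi ← All.lookup (IsTableau.inShape T) (here refl) (i , 1) i1∈G =
        lastRow shape (≤-trans 1≤fi (antitone {f} (Shape.step-antitone shape) ≤-refl 1≤i))
      open BottomHook shape T last using (k; shape′; tableau′)
      len′ : length (removeAt (G ∷ R) k) ≡ n
      len′ = suc-injective (trans (sym (length-removeAt′ (G ∷ R) k)) len)

module _ {L : ℕ} where

  initials-on-row-diagonals : ∀ {f R} → Shape L f → IsTableau L f R → InitialsOnRowDiagonals L f R
  initials-on-row-diagonals =
    tableau-induction (InitialsOnRowDiagonals L) (λ _ _ ()) (λ shape T last → BottomHookPerm.initials-on-row-diagonals-step shape T last)

  perm-exists : ∀ {f R} → Shape L f → IsTableau L f R → Σ[ π ∈ Permutation′ L ] IsPermSRT L f R (π ⟨$⟩ʳ_)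
  perm-exists = tableau-induction (λ f R → Σ[ π ∈ Permutation′ L ] IsPermSRT L f R (π ⟨$⟩ʳ_))
    (λ shape T → Perm.id , identity-perm shape T)
    (λ shape T last (π′ , P′) → let open BottomHookPerm shape T last in
       rotation ∘ₚ π′ , perm-lift (initials-on-row-diagonals shape′ tableau′) P′)

  perm-sign : ∀ {f R} → Shape L f → IsTableau L f R →
              ∀ {σ} → Injective _≡_ _≡_ σ → IsPermSRT L f R σ → sgnSRT R ≡ sgnOf (inversions σ)
  perm-sign = tableau-induction (λ f R → ∀ {σ} → Injective _≡_ _≡_ σ → IsPermSRT L f R σ → sgnSRT R ≡ sgnOf (inversions σ))
    (λ shape T _ P → cong sgnOf (sym (trans (inversions-cong (perm-on-empty shape T P)) (inversions-id {L}))))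
    (λ shape T last ih {σ} σ-injective P → let open BottomHookPerm shape T last in
       sign-step shape T last σ-injective P (ih (λ eq → unrotateF-injective (σ-injective eq)) (perm-restrict P)))

  perm-injective : ∀ {f R} → Shape L f → IsTableau L f R →
                   ∀ {R₂ σ} → IsTableau L f R₂ → Injective _≡_ _≡_ σ → IsPermSRT L f R σ → IsPermSRT L f R₂ σ → SameSRT R R₂
  perm-injective = tableau-induction
    (λ f R → ∀ {R₂ σ} → IsTableau L f R₂ → Injective _≡_ _≡_ σ → IsPermSRT L f R σ → IsPermSRT L f R₂ σ → SameSRT R R₂)
    (λ shape T T₂ _ _ _ → (λ _ ()) , (λ _ G₂∈R₂ → contradiction G₂∈R₂ (no-hooks shape T T₂)))
    (λ shape T last ih T₂ σ-injective P P₂ → injective-step shape T T₂ last σ-injective P P₂ ih)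

part-vanishes : ∀ μ {i} → length μ < i → part μ i ≡ 0
part-vanishes [] {suc i} _ = refl
part-vanishes (x ∷ μ) {suc (suc i)} (s≤s μ<i+1) = part-vanishes μ μ<i+1

partition-shape : ∀ {μ} → IsPartition μ → Shape (length μ) (part μ)
partition-shape {μ} (_ , μ-antitone) = record { step-antitone = μ-antitone ; vanishes = part-vanishes μ }

IsSRT⇒IsTableau : ∀ {μ R} → IsSRT μ R → IsTableau (length μ) (part μ) R
IsSRT⇒IsTableau (rimHooks , firstColumn , H⊆μ , μ⊆R , disjoint) = record
  { rimHooks = rimHooks
  ; meetFirstColumn = firstColumn
  ; inShape = All.map (λ G⊆μ (i , j) → G⊆μ (i , j)) H⊆μ
  ; covers = λ (i , j) → μ⊆R (i , j)
  ; disjoint = disjoint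
  }

permutation-injective : ∀ {L} (π : Permutation′ L) → Injective _≡_ _≡_ (π ⟨$⟩ʳ_)
permutation-injective π = Injection.injective (↔⇒↣ π)

theorem6p4 : (n : ℕ) (μ : List ℕ) → IsPartitionOf n μ →
    ((R : List (List Cell)) → IsSRT μ R →
      Σ[ π ∈ Permutation′ (length μ) ] PermSRT μ R (π ⟨$⟩ʳ_))
    × ((R R' : List (List Cell)) (π : Permutation′ (length μ)) → IsSRT μ R → IsSRT μ R' →
      PermSRT μ R (π ⟨$⟩ʳ_) → PermSRT μ R' (π ⟨$⟩ʳ_) → SameSRT R R')
    × ((R : List (List Cell)) (π : Permutation′ (length μ)) → IsSRT μ R →
      PermSRT μ R (π ⟨$⟩ʳ_) → sgnSRT R ≡ sgnPerm π)
theorem6p4 n μ (μ-partition , _) =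
  (λ R srt → perm-exists shape (IsSRT⇒IsTableau srt)) ,
  (λ R R′ π srt srt′ P P′ → perm-injective shape (IsSRT⇒IsTableau srt) (IsSRT⇒IsTableau srt′) (permutation-injective π) P P′) ,
  (λ R π srt P → perm-sign shape (IsSRT⇒IsTableau srt) (permutation-injective π) P)
  where
  shape = partition-shape μ-partition
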